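{- Let $G=(V,E)$ be a simple undirected graph with edge weights $\omega\colon E\to\mathbb N$ that admits a TSP tour, let $C\subseteq V$ be a vertex cover of $G$ with $|C|\le 2\tau$, let $H$ be the hop graph for $G$ and $C$ (with parts $X=(C)_2$ and $Y=V\setminus C$), let $M^*$ be a maximum-cardinality matching in $H$ that has minimum total cost with respect to $\omega^H$ among all maximum-cardinality matchings of $H$, and let $S\subseteq Y$ be the set of vertices of $Y$ matched by $M^*$. Then there exists an optimal TSP tour $P^*$ of $G$ such that $S$ contains all vertices that $P^*$ traverses via hops.
   Context: $\tau$ is the minimum size of a vertex cover of $G$ (a set of vertices containing an endpoint of every edge). For a set $V$, $(V)_2:=(V\times V)\setminus\{(v,v)\mid v\in V\}$. $N(v)$ is the open neighborhood of $v$. A walk is a sequence $(v_0,\dots,v_\ell)$ of vertices with consecutive vertices adjacent (vertices may repeat); it is closed if $v_0=v_\ell$; its weight is the sum of $\omega$ over its consecutive pairs. A TSP tour of $G$ is a closed walk containing all vertices of $G$; it is optimal if it has minimum weight. Every vertex $s\in V\setminus C$ has all neighbors in $C$, so each occurrence of $s$ in a TSP tour is within a subwalk (consecutive vertices) $(u,s,v)$ with $u,v\in C$; it is called a hop if $u\ne v$ and a loop if $u=v$; the tour traverses $s$ via a hop if some occurrence of $s$ is a hop. The hop graph $H$ is the edge-weighted bipartite graph on $X:=(C)_2$ and $Y:=V\setminus C$ containing, for each $x=(u,v)\in X$ and each $y\in (N(u)\cap N(v))\setminus C$, an edge $\{x,y\}$ of cost $\omega^H(\{x,y\}):=\omega(\{u,y\})+\omega(\{y,v\})-2\omega_{\min}(y)$,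 where $\omega_{\min}(s):=\min_{w\in N(s)}\omega(\{s,w\})$. -}

module Defs where

open import Data.Nat using (ℕ; zero; suc; _+_; _*_; _∸_; _≤_; _⊓_)
open import Data.Fin using (Fin)
open import Data.Fin.Subset using (Subset; _∈_; _∉_; ∣_∣)
open import Data.List using (List; []; _∷_; _++_; [_]; map; filter; head; last; length; allFin; foldr)
open import Data.Nat.ListAction using (sum)
open import Data.List.Relation.Unary.All using (All)
open import Data.List.Relation.Unary.AllPairs using (AllPairs)
open import Data.List.Relation.Unary.Linked using (Linked)
import Data.List.Membership.Propositional as Mem
open import Data.Maybe using (just)
open import Data.Product using (Σ; ∃; ∃-syntax; _×_; _,_; proj₁; proj₂)
open import Data.Sum using (_⊎_)
open import Relation.Binary.PropositionalEquality using (_≡_; _≢_)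
open import Relation.Nullary using (Dec; ¬_)

record Graph (n : ℕ) : Set₁ where
  field
    E      : Fin n → Fin n → Set
    E?     : ∀ u v → Dec (E u v)
    E-sym  : ∀ {u v} → E u v → E v u
    E-irr  : ∀ {u} → ¬ E u u
open Graph public

-- Edge weights ω : E → ℕ, given as a symmetric function on pairs
-- (values on non-adjacent pairs are never used).
Weight : ℕ → Set
Weight n = Fin n → Fin n → ℕ

Symmetric : ∀ {n} → Weight n → Set
Symmetric ω = ∀ u v → ω u v ≡ ω v u

module _ {n : ℕ} (G : Graph n) (ω : Weight n) where

  IsVertexCover : Subset n → Set
  IsVertexCover C = ∀ u v → E G u v → u ∈ C ⊎ v ∈ C

  IsMinVertexCoverSize : ℕ → Set
  IsMinVertexCoverSize τ =
    (Σ (Subset n) λ D → IsVertexCover D × ∣ D ∣ ≡ τ) ×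
    (∀ D → IsVertexCover D → τ ≤ ∣ D ∣)

  IsWalk : List (Fin n) → Set
  IsWalk vs = (∃[ v ] head vs ≡ just v) × Linked (E G) vs

  IsClosedWalk : List (Fin n) → Set
  IsClosedWalk vs = IsWalk vs × (∃[ v ] (head vs ≡ just v × last vs ≡ just v))

  walkWeight : List (Fin n) → ℕ
  walkWeight (x ∷ y ∷ r) = ω x y + walkWeight (y ∷ r)
  walkWeight _           = 0

  IsTSPTour : List (Fin n) → Set
  IsTSPTour vs = IsClosedWalk vs × (∀ v → v Mem.∈ vs)

  IsOptimalTSPTour : List (Fin n) → Set
  IsOptimalTSPTour vs = IsTSPTour vs × (∀ ws → IsTSPTour ws → walkWeight vs ≤ walkWeight ws)

  -- The occurrences of vertices in a closed walk (v₀,…,v_ℓ) are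
  -- read cyclically: the occurrence v₀ = v_ℓ sits in the subwalk
  -- (v_{ℓ-1}, v₀, v₁).  The cyclic triples are exactly the consecutive
  -- triples of (v₀,…,v_ℓ,v₁).

  data HasTriple (u s v : Fin n) : List (Fin n) → Set where
    here  : ∀ {xs} → HasTriple u s v (u ∷ s ∷ v ∷ xs)
    there : ∀ {x xs} → HasTriple u s v xs → HasTriple u s v (x ∷ xs)

  cyclicExt : List (Fin n) → List (Fin n)
  cyclicExt (x ∷ y ∷ r) = x ∷ y ∷ r ++ [ y ]
  cyclicExt vs          = vs

  TraversesViaHop : Subset n → List (Fin n) → Fin n → Set
  TraversesViaHop C P s =
    s ∉ C × (∃[ u ] ∃[ v ] (u ≢ v × HasTriple u s v (cyclicExt P)))

  minList : List ℕ → ℕ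
  minList []       = 0          -- never used: only applied to vertices with a neighbour
  minList (x ∷ xs) = foldr _⊓_ x xs

  ωmin : Fin n → ℕ
  ωmin s = minList (map (ω s) (filter (E? G s) (allFin n)))

  -- The hop graph H for G and C.  An edge {x,y} with x = (u,v) ∈ (C)₂ and
  -- y ∈ Y = V ∖ C is represented by the triple (u , v , y).

  HEdge : Subset n → Fin n × Fin n × Fin n → Set
  HEdge C (u , v , y) =
    u ∈ C × v ∈ C × u ≢ v × y ∉ C × E G u y × E G v y

  hcost : Fin n × Fin n × Fin n → ℕ
  hcost (u , v , y) = (ω u y + ω y v) ∸ 2 * ωmin y

  xPart : Fin n × Fin n × Fin n → Fin n × Fin n
  xPart (u , v , _) = u , v

  yPart : Fin n × Fin n × Fin n → Fin n
  yPart (_ , _ , y) = y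

  IsMatching : Subset n → List (Fin n × Fin n × Fin n) → Set
  IsMatching C M =
    All (HEdge C) M × AllPairs (λ e f → xPart e ≢ xPart f × yPart e ≢ yPart f) M

  matchingCost : List (Fin n × Fin n × Fin n) → ℕ
  matchingCost M = sum (map hcost M)

  IsMaxCardMatching : Subset n → List (Fin n × Fin n × Fin n) → Set
  IsMaxCardMatching C M =
    IsMatching C M × (∀ M′ → IsMatching C M′ → length M′ ≤ length M)

  IsMinCostMaxCardMatching : Subset n → List (Fin n × Fin n × Fin n) → Set
  IsMinCostMaxCardMatching C M =
    IsMaxCardMatching C M ×
    (∀ M′ → IsMaxCardMatching C M′ → matchingCost M ≤ matchingCost M′)

  MatchedBy : List (Fin n × Fin n × Fin n) → Fin n → Set
  MatchedBy M y = ∃[ e ] (e Mem.∈ M × yPart e ≡ y)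

{-# OPTIONS --safe #-}
-- An optimal tour exists because every tour can be shortcut, without getting heavier, to one of length at most n².
-- Rotated to start in C, it is improved without increasing its weight until every hop passes through a vertex
-- matched by M*. If two hops u x v and u y v have the same ordered ends, both are cut out and x, y are revisited
-- by loops through a lightest edge, which cost 2 ω_min ≤ the weight of any hop. Otherwise a hop u₀ s v₀ with s
-- unmatched starts an exchange along an M*-alternating path; it keeps the number of hops, removes an unmatched
-- hop, and does not increase the weight because M* is cheapest among the maximum matchings.
module Submission where

open import Defs
open import Data.Empty using (⊥; ⊥-elim)
open import Data.Fin using (Fin; _≟_)
open import Data.Fin.Properties using () renaming (all? to all-Fin?; any? to any-Fin?)
open import Data.Fin.Subset using (Subset; _∈_; _∉_; ∣_∣)
import Data.Fin.Subset.Properties as Subset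
open import Data.List using (List; []; _∷_; _++_; [_]; _∷ʳ_; map; concat; filter; head; last; length; allFin; reverse)
open import Data.List.Extrema.Nat using (argmin; argmin-all; f[argmin]≤f[xs])
open import Data.List.Membership.Propositional using (find; lose) renaming (_∈_ to _∈ₗ_; _∉_ to _∉ₗ_)
open import Data.List.Membership.Propositional.Properties
  using (∈-++⁺ˡ; ∈-++⁺ʳ; ∈-++⁻; ∈-∃++; ∈-allFin; ∈-concat⁺′; ∈-map⁺; ∈-map⁻; ∈-filter⁺; ∈-filter⁻; foldr-selective)
import Data.List.Membership.DecPropositional as DecMembership
open import Data.List.Properties using (++-assoc; unfold-reverse; reverse-++; length-++; length-tabulate; foldr-preservesᵒ)
open import Data.List.Relation.Binary.Subset.Propositional using (_⊆_)
open import Data.List.Relation.Binary.Subset.Propositional.Properties using (xs⊆xs++ys)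
open import Data.List.Relation.Unary.All as All using (All; []; _∷_)
open import Data.List.Relation.Unary.All.Properties using (all-filter; ++⁻ˡ; ++⁻ʳ; ¬Any⇒All¬) renaming (++⁺ to All-++⁺)
open import Data.List.Relation.Unary.AllPairs using (AllPairs; []; _∷_)
open import Data.List.Relation.Unary.Any as Any using (Any; here; there)
open import Data.List.Relation.Unary.Any.Properties using (reverse⁺)
open import Data.List.Relation.Unary.Linked using (Linked; []; [-]; _∷_)
open import Data.List.Relation.Unary.Unique.Propositional using (Unique)
import Data.List.Relation.Unary.Unique.Propositional.Properties as Unique
open import Data.Maybe using (just)
open import Data.Maybe.Properties using (just-injective)
open import Data.Nat using (ℕ; zero; suc; _+_; _*_; _≤_; _<_; z≤n; s≤s; z<s)
open import Data.Nat.Properties hiding (_≟_)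
open import Data.Nat.Tactic.RingSolver using (solve-∀)
open import Data.Product using (∃-syntax; ∃₂; _×_; _,_; proj₁; proj₂)
open import Data.Product.Properties using (≡-dec)
open import Data.Sum using (_⊎_; inj₁; inj₂; [_,_]′)
open import Function using (_∘_; id)
open import Relation.Binary using (Rel)
open import Relation.Binary.PropositionalEquality
  using (_≡_; _≢_; refl; sym; trans; cong; cong₂; subst; module ≡-Reasoning)
open import Relation.Nullary using (Dec; yes; no; ¬_)
open import Relation.Nullary.Decidable using (_×-dec_; ¬?; map′; decidable-stable)

module _ {a} {A : Set a} where

  head-++-∷ : ∀ xs (x : A) ys zs → head (xs ++ x ∷ ys) ≡ head (xs ++ x ∷ zs)
  head-++-∷ []      x ys zs = refl
  head-++-∷ (_ ∷ _) x ys zs = refl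

  head-++ : ∀ xs ys {x : A} → head xs ≡ just x → head (xs ++ ys) ≡ just x
  head-++ (_ ∷ _) ys eq = eq

  last-++-∷ : ∀ xs (x : A) ys → last (xs ++ x ∷ ys) ≡ last (x ∷ ys)
  last-++-∷ []           x ys = refl
  last-++-∷ (_ ∷ [])     x ys = refl
  last-++-∷ (_ ∷ y ∷ xs) x ys = last-++-∷ (y ∷ xs) x ys

  last-∷ʳ : ∀ xs (x : A) → last (xs ++ [ x ]) ≡ just x
  last-∷ʳ xs x = last-++-∷ xs x []

  last-∷ : ∀ (x : A) xs → ∃[ y ] last (x ∷ xs) ≡ just y
  last-∷ x []       = x , refl
  last-∷ x (y ∷ xs) = last-∷ y xs

  ∷-∷ʳ : ∀ (x : A) xs → ∃₂ λ ys y → x ∷ xs ≡ ys ++ [ y ]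
  ∷-∷ʳ x []       = [] , x , refl
  ∷-∷ʳ x (y ∷ xs) with ∷-∷ʳ y xs
  ... | ys , z , eq = x ∷ ys , z , cong (x ∷_) eq

  reverse-∷-∷ : ∀ (x y : A) xs → reverse (x ∷ y ∷ xs) ≡ (reverse xs ∷ʳ y) ∷ʳ x
  reverse-∷-∷ x y xs = trans (unfold-reverse x (y ∷ xs)) (cong (_∷ʳ x) (unfold-reverse y xs))

  ∈-++-∷-≢ : ∀ {z x : A} xs ys → z ∈ₗ xs ++ x ∷ ys → z ≢ x → z ∈ₗ xs ++ ys
  ∈-++-∷-≢ []       ys (here z≡x) z≢x = ⊥-elim (z≢x z≡x)
  ∈-++-∷-≢ []       ys (there z∈) z≢x = z∈
  ∈-++-∷-≢ (_ ∷ xs) ys (here z≡y) z≢x = here z≡y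
  ∈-++-∷-≢ (_ ∷ xs) ys (there z∈) z≢x = there (∈-++-∷-≢ xs ys z∈ z≢x)

  module _ {r} {R : Rel A r} where

    Linked-++-∷⁻ : ∀ xs x ys → Linked R (xs ++ x ∷ ys) → Linked R (xs ++ [ x ]) × Linked R (x ∷ ys)
    Linked-++-∷⁻ []           x ys l       = [-] , l
    Linked-++-∷⁻ (_ ∷ [])     x ys (r ∷ l) = r ∷ [-] , l
    Linked-++-∷⁻ (_ ∷ y ∷ xs) x ys (r ∷ l) = let (l₁ , l₂) = Linked-++-∷⁻ (y ∷ xs) x ys l in r ∷ l₁ , l₂

    Linked-++-∷⁺ : ∀ xs x ys → Linked R (xs ++ [ x ]) → Linked R (x ∷ ys) → Linked R (xs ++ x ∷ ys)
    Linked-++-∷⁺ []           x ys _        l = l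
    Linked-++-∷⁺ (_ ∷ [])     x ys (r ∷ _)  l = r ∷ l
    Linked-++-∷⁺ (_ ∷ y ∷ xs) x ys (r ∷ l₁) l = r ∷ Linked-++-∷⁺ (y ∷ xs) x ys l₁ l

    Linked-∷ʳ : ∀ xs {y} x → last xs ≡ just y → Linked R xs → R y x → Linked R (xs ++ [ x ])
    Linked-∷ʳ []           x ()   _       _
    Linked-∷ʳ (_ ∷ [])     x refl _       r = r ∷ [-]
    Linked-∷ʳ (_ ∷ y ∷ xs) x eq   (r′ ∷ l) r = r′ ∷ Linked-∷ʳ (y ∷ xs) x eq l r

    Linked-reverse : (∀ {x y} → R x y → R y x) → ∀ xs → Linked R xs → Linked R (reverse xs)
    Linked-reverse sym-R []           _       = []
    Linked-reverse sym-R (_ ∷ [])     _       = [-]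
    Linked-reverse sym-R (x ∷ y ∷ xs) (r ∷ l) =
      subst (Linked R) (sym (reverse-∷-∷ x y xs))
        (Linked-∷ʳ (reverse xs ++ [ y ]) x (last-∷ʳ (reverse xs) y)
          (subst (Linked R) (unfold-reverse y xs) (Linked-reverse sym-R (y ∷ xs) l)) (sym-R r))

  AllPairs-++⁻ˡ : ∀ {r} {R : Rel A r} xs {ys} → AllPairs R (xs ++ ys) → AllPairs R xs
  AllPairs-++⁻ˡ []       _        = []
  AllPairs-++⁻ˡ (x ∷ xs) (a ∷ ps) = ++⁻ˡ xs a ∷ AllPairs-++⁻ˡ xs ps

  Unique-∷ʳ : ∀ {xs} {x : A} → Unique xs → x ∉ₗ xs → Unique (xs ++ [ x ])
  Unique-∷ʳ u x∉ = Unique.++⁺ u ([] ∷ []) λ { (z∈ , here refl) → x∉ z∈ }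

  Unique-⊆⇒length-≤ : ∀ {xs ys : List A} → Unique xs → xs ⊆ ys → length xs ≤ length ys
  Unique-⊆⇒length-≤ {[]}     _        _  = z≤n
  Unique-⊆⇒length-≤ {x ∷ xs} (x∉ ∷ u) xs⊆ys with ∈-∃++ (xs⊆ys (here refl))
  ... | ys₁ , ys₂ , refl = begin
    suc (length xs)               ≤⟨ s≤s (Unique-⊆⇒length-≤ u xs⊆ys₁ys₂) ⟩
    suc (length (ys₁ ++ ys₂))     ≡⟨ cong suc (length-++ ys₁) ⟩
    suc (length ys₁ + length ys₂) ≡⟨ +-suc (length ys₁) (length ys₂) ⟨
    length ys₁ + length (x ∷ ys₂) ≡⟨ length-++ ys₁ ⟨
    length (ys₁ ++ x ∷ ys₂)       ∎
    where
    open ≤-Reasoning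
    xs⊆ys₁ys₂ : xs ⊆ ys₁ ++ ys₂
    xs⊆ys₁ys₂ z∈ = ∈-++-∷-≢ ys₁ ys₂ (xs⊆ys (there z∈)) λ { refl → All.lookup x∉ z∈ refl }

  All-swap : ∀ {p} {P : A → Set p} xs {e e′ ys} → All P (xs ++ e ∷ ys) → P e′ → All P (xs ++ e′ ∷ ys)
  All-swap xs ps p = All-++⁺ (++⁻ˡ xs ps) (p ∷ All.tail (++⁻ʳ xs ps))

  AllPairs-swap : ∀ {r} {R : Rel A r} xs {e e′ ys} → AllPairs R (xs ++ e ∷ ys) →
                  All (λ g → R g e → R g e′) xs → All (λ g → R e g → R e′ g) ys → AllPairs R (xs ++ e′ ∷ ys)
  AllPairs-swap []       (r ∷ ps) []       gs = All.zipWith (λ (g , r) → g r) (gs , r) ∷ ps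
  AllPairs-swap (x ∷ xs) (r ∷ ps) (f ∷ fs) gs =
    All-swap xs r (f (All.lookup r (∈-++⁺ʳ xs (here refl)))) ∷ AllPairs-swap xs ps fs gs

  AllPairs-++-∷⁻ : ∀ {r} {R : Rel A r} xs {e ys} → AllPairs R (xs ++ e ∷ ys) → All (λ g → R g e) xs × All (R e) ys
  AllPairs-++-∷⁻ []       (r ∷ _)  = [] , r
  AllPairs-++-∷⁻ (x ∷ xs) (r ∷ ps) =
    let (l , r′) = AllPairs-++-∷⁻ xs ps in All.lookup r (∈-++⁺ʳ xs (here refl)) ∷ l , r′

  ∈-swap⁻ : ∀ xs {e e′ ys} {g : A} → g ∈ₗ xs ++ e′ ∷ ys → g ≡ e′ ⊎ g ∈ₗ xs ++ e ∷ ys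
  ∈-swap⁻ xs g∈ with ∈-++⁻ xs g∈
  ... | inj₁ g∈xs         = inj₂ (∈-++⁺ˡ g∈xs)
  ... | inj₂ (here g≡e′)  = inj₁ g≡e′
  ... | inj₂ (there g∈ys) = inj₂ (∈-++⁺ʳ xs (there g∈ys))

  ∈-swap⁺ : ∀ xs {e e′ ys} {g : A} → g ∈ₗ xs ++ e ∷ ys → g ≢ e → g ∈ₗ xs ++ e′ ∷ ys
  ∈-swap⁺ xs g∈ g≢e with ∈-++⁻ xs g∈
  ... | inj₁ g∈xs         = ∈-++⁺ˡ g∈xs
  ... | inj₂ (here g≡e)   = ⊥-elim (g≢e g≡e)
  ... | inj₂ (there g∈ys) = ∈-++⁺ʳ xs (there g∈ys)

  length-swap : ∀ xs {e e′ : A} ys → length (xs ++ e′ ∷ ys) ≡ length (xs ++ e ∷ ys)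
  length-swap xs ys = trans (length-++ xs) (sym (length-++ xs))

Unique⇒length≤ : ∀ {n} {xs : List (Fin n)} → Unique xs → length xs ≤ n
Unique⇒length≤ {n} {xs} u = subst (length xs ≤_) (length-tabulate id) (Unique-⊆⇒length-≤ u λ {z} _ → ∈-allFin z)

+-swap₂₃ : ∀ x p q → x + p + q ≡ x + q + p
+-swap₂₃ = solve-∀

+-swap₂₄ : ∀ x p y q → x + p + y + q ≡ x + q + y + p
+-swap₂₄ = solve-∀

+-swap-inner : ∀ x p y q → x + (p + y) + q ≡ x + (q + y) + p
+-swap-inner = solve-∀

+-pull-out : ∀ x p m q y → x + p + (m + q + y) ≡ x + (m + y) + (p + q)
+-pull-out = solve-∀

-- One exchange step trades the hop through f for the hop through t (walk weights hopf, hopt, hop-graph costs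
-- costf, costt, loop prices loopf, loopt); w, c and w′, c′ are walk weight and matching cost before and after.
balance-step : ∀ {w′ c′ s k w c costf costt hopf hopt loopf loopt : ℕ} →
               w′ + hopf ≡ w + hopt → c′ + costt ≡ c + costf → costf + loopf ≡ hopf → costt + loopt ≡ hopt →
               w + c + s ≡ k + loopf → w′ + c′ + s ≡ k + loopt
balance-step {w′} {c′} {s} {k} {w} {c} {costf} {costt} {hopf} {hopt} {loopf} {loopt} e₁ e₂ e₃ e₄ e₅ =
  +-cancelʳ-≡ (hopf + costt) (w′ + c′ + s) (k + loopt) (begin
    w′ + c′ + s + (hopf + costt)   ≡⟨ regroup₁ w′ c′ s hopf costt ⟩
    (w′ + hopf) + (c′ + costt) + s ≡⟨ cong₂ (λ x y → x + y + s) e₁ e₂ ⟩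
    (w + hopt) + (c + costf) + s   ≡⟨ regroup₂ w hopt c costf s ⟩
    (w + c + s) + hopt + costf     ≡⟨ cong (λ x → x + hopt + costf) e₅ ⟩
    k + loopf + hopt + costf       ≡⟨ regroup₃ k loopf hopt costf ⟩
    k + (costf + loopf) + hopt     ≡⟨ cong (λ x → k + x + hopt) e₃ ⟩
    k + hopf + hopt                ≡⟨ cong (k + hopf +_) e₄ ⟨
    k + hopf + (costt + loopt)     ≡⟨ regroup₄ k hopf costt loopt ⟩
    k + loopt + (hopf + costt)     ∎)
  where
  open ≡-Reasoning
  regroup₁ : ∀ a b s p q → a + b + s + (p + q) ≡ (a + p) + (b + q) + s
  regroup₁ = solve-∀
  regroup₂ : ∀ a p b q s → (a + p) + (b + q) + s ≡ (a + b + s) + p + q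
  regroup₂ = solve-∀
  regroup₃ : ∀ k l p q → k + l + p + q ≡ k + (q + l) + p
  regroup₃ = solve-∀
  regroup₄ : ∀ k p q l → k + p + (q + l) ≡ k + l + (p + q)
  regroup₄ = solve-∀

balance-finish : ∀ {wt wq′ wq wp s f c c* : ℕ} →
                 wt ≤ wq′ + s → wq′ + f ≤ wq → wq + c + s ≡ wp + c* + f → c* ≤ c → wt ≤ wp
balance-finish {wt} {wq′} {wq} {wp} {s} {f} {c} {c*} t≤ q′≤ balance c*≤c =
  +-cancelʳ-≤ (f + c) wt wp (begin
    wt + (f + c)      ≤⟨ +-monoˡ-≤ (f + c) t≤ ⟩
    wq′ + s + (f + c) ≡⟨ regroup₁ wq′ s f c ⟩
    wq′ + f + c + s   ≤⟨ +-monoˡ-≤ s (+-monoˡ-≤ c q′≤) ⟩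
    wq + c + s        ≡⟨ balance ⟩
    wp + c* + f       ≤⟨ +-monoˡ-≤ f (+-monoʳ-≤ wp c*≤c) ⟩
    wp + c + f        ≡⟨ regroup₂ wp c f ⟩
    wp + (f + c)      ∎)
  where
  open ≤-Reasoning
  regroup₁ : ∀ a s f c → a + s + (f + c) ≡ a + f + c + s
  regroup₁ = solve-∀
  regroup₂ : ∀ a c f → a + c + f ≡ a + (f + c)
  regroup₂ = solve-∀

module Walks {n : ℕ} (G : Graph n) (ω : Weight n) where

  open DecMembership (_≟_ {n}) using (_∈?_) public

  W : List (Fin n) → ℕ
  W = walkWeight G ω

  Adjacent : List (Fin n) → Set
  Adjacent = Linked (E G)

  Triple : Fin n → Fin n → Fin n → List (Fin n) → Set
  Triple = HasTriple G ω

  Tour : List (Fin n) → Set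
  Tour = IsTSPTour G ω

  W-++-∷ : ∀ xs x ys → W (xs ++ x ∷ ys) ≡ W (xs ++ [ x ]) + W (x ∷ ys)
  W-++-∷ []           x ys = refl
  W-++-∷ (a ∷ [])     x ys = cong (_+ W (x ∷ ys)) (sym (+-identityʳ (ω a x)))
  W-++-∷ (a ∷ b ∷ xs) x ys = trans (cong (ω a b +_) (W-++-∷ (b ∷ xs) x ys)) (sym (+-assoc (ω a b) _ _))

  W-∷ʳ : ∀ xs {y} x → last xs ≡ just y → W (xs ++ [ x ]) ≡ W xs + ω y x
  W-∷ʳ []           x ()
  W-∷ʳ (a ∷ [])     x refl = +-identityʳ (ω a x)
  W-∷ʳ (a ∷ b ∷ xs) x eq   = trans (cong (ω a b +_) (W-∷ʳ (b ∷ xs) x eq)) (sym (+-assoc (ω a b) _ _))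

  W-reverse : Symmetric ω → ∀ xs → W (reverse xs) ≡ W xs
  W-reverse ω-sym []           = refl
  W-reverse ω-sym (_ ∷ [])     = refl
  W-reverse ω-sym (x ∷ y ∷ xs) = begin
    W (reverse (x ∷ y ∷ xs))           ≡⟨ cong W (reverse-∷-∷ x y xs) ⟩
    W ((reverse xs ++ [ y ]) ++ [ x ]) ≡⟨ W-∷ʳ (reverse xs ++ [ y ]) x (last-∷ʳ (reverse xs) y) ⟩
    W (reverse xs ++ [ y ]) + ω y x    ≡⟨ cong₂ _+_ (cong W (unfold-reverse y xs)) (ω-sym x y) ⟨
    W (reverse (y ∷ xs)) + ω x y       ≡⟨ cong (_+ ω x y) (W-reverse ω-sym (y ∷ xs)) ⟩
    W (y ∷ xs) + ω x y                 ≡⟨ +-comm (W (y ∷ xs)) (ω x y) ⟩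
    W (x ∷ y ∷ xs)                     ∎
    where open ≡-Reasoning

  triple⇒split : ∀ {u y v xs} → Triple u y v xs → ∃₂ λ ys zs → xs ≡ ys ++ u ∷ y ∷ v ∷ zs
  triple⇒split (here {xs}) = [] , xs , refl
  triple⇒split (there {x} t) = let (ys , zs , eq) = triple⇒split t in x ∷ ys , zs , cong (x ∷_) eq

  split⇒triple : ∀ {u y v} ys zs → Triple u y v (ys ++ u ∷ y ∷ v ∷ zs)
  split⇒triple []       zs = here
  split⇒triple (_ ∷ ys) zs = there (split⇒triple ys zs)

  triple⇒adjacent : ∀ {u y v xs} → Adjacent xs → Triple u y v xs → E G u y × E G y v
  triple⇒adjacent (e ∷ e′ ∷ _) here      = e , e′
  triple⇒adjacent (_ ∷ l)      (there t) = triple⇒adjacent l t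

  triple⇒∈ : ∀ {u y v xs} → Triple u y v xs → y ∈ₗ xs
  triple⇒∈ here      = there (here refl)
  triple⇒∈ (there t) = there (triple⇒∈ t)

  triple? : ∀ u y v xs → Dec (Triple u y v xs)
  triple? u y v []               = no λ ()
  triple? u y v (_ ∷ [])         = no λ { (there ()) }
  triple? u y v (_ ∷ _ ∷ [])     = no λ { (there (there ())) }
  triple? u y v (a ∷ b ∷ c ∷ xs) with triple? u y v (b ∷ c ∷ xs) | a ≟ u | b ≟ y | c ≟ v
  ... | yes t | _        | _        | _        = yes (there t)
  ... | no ¬t | yes refl | yes refl | yes refl = yes here
  ... | no ¬t | no a≢u   | _        | _        = no λ { here → a≢u refl ; (there t) → ¬t t }
  ... | no ¬t | yes _    | no b≢y   | _        = no λ { here → b≢y refl ; (there t) → ¬t t }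
  ... | no ¬t | yes _    | yes _    | no c≢v   = no λ { here → c≢v refl ; (there t) → ¬t t }

  triple-∷ʳ⁻ : ∀ {u y v} xs x → Triple u y v (xs ++ [ x ]) → Triple u y v xs ⊎ last xs ≡ just y
  triple-∷ʳ⁻ (_ ∷ _ ∷ [])     x here      = inj₂ refl
  triple-∷ʳ⁻ (_ ∷ _ ∷ _ ∷ xs) x here      = inj₁ here
  triple-∷ʳ⁻ []               x (there ())
  triple-∷ʳ⁻ (_ ∷ [])         x (there (there ()))
  triple-∷ʳ⁻ (_ ∷ _ ∷ [])     x (there (there (there ())))
  triple-∷ʳ⁻ (_ ∷ b ∷ c ∷ xs) x (there t) with triple-∷ʳ⁻ (b ∷ c ∷ xs) x t
  ... | inj₁ t′ = inj₁ (there t′)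
  ... | inj₂ eq = inj₂ eq

-- Shortening tours

module Compression {n : ℕ} (G : Graph n) (ω : Weight n) (t₀ : Fin n) (ts : List (Fin n)) where

  open Walks G ω

  T : List (Fin n)
  T = t₀ ∷ ts

  -- kept stands for the part of T read so far, which ends at c; c ∷ rest is the unread part.
  record Prefix (c : Fin n) (rest kept : List (Fin n)) : Set where
    field
      adjacent     : Adjacent kept
      head-kept    : head kept ≡ just t₀
      last-kept    : last kept ≡ just c
      weight-bound : W kept + W (c ∷ rest) ≤ W T
      covers       : ∀ {z} → z ∈ₗ T → z ∈ₗ kept ⊎ z ∈ₗ rest
      last-T       : last T ≡ last (c ∷ rest)

  -- Appending the next vertex x and then cutting out the closed subwalk x ∷ mid.
  prefix-step : ∀ {c x rest kept} pre mid → Prefix c (x ∷ rest) kept → E G c x →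
                kept ++ [ x ] ≡ pre ++ x ∷ mid → kept ⊆ pre ++ [ x ] → Prefix x rest (pre ++ [ x ])
  prefix-step {c} {x} {rest} {kept} pre mid p e eq kept⊆ = record
    { adjacent     = proj₁ (Linked-++-∷⁻ pre x mid (subst Adjacent eq (Linked-∷ʳ kept x last-kept adjacent e)))
    ; head-kept    = trans (head-++-∷ pre x [] mid) (trans (cong head (sym eq)) (head-++ kept [ x ] head-kept))
    ; last-kept    = last-∷ʳ pre x
    ; weight-bound = begin
        W (pre ++ [ x ]) + W (x ∷ rest) ≤⟨ +-monoˡ-≤ (W (x ∷ rest)) shortcut ⟩
        (W kept + ω c x) + W (x ∷ rest) ≡⟨ +-assoc (W kept) (ω c x) (W (x ∷ rest)) ⟩
        W kept + W (c ∷ x ∷ rest)       ≤⟨ weight-bound ⟩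
        W T                             ∎
    ; covers       = covers′
    ; last-T       = last-T }
    where
    open Prefix p
    open ≤-Reasoning
    shortcut : W (pre ++ [ x ]) ≤ W kept + ω c x
    shortcut = begin
      W (pre ++ [ x ])               ≤⟨ m≤m+n (W (pre ++ [ x ])) (W (x ∷ mid)) ⟩
      W (pre ++ [ x ]) + W (x ∷ mid) ≡⟨ W-++-∷ pre x mid ⟨
      W (pre ++ x ∷ mid)             ≡⟨ cong W eq ⟨
      W (kept ++ [ x ])              ≡⟨ W-∷ʳ kept x last-kept ⟩
      W kept + ω c x                 ∎
    covers′ : ∀ {z} → z ∈ₗ T → z ∈ₗ pre ++ [ x ] ⊎ z ∈ₗ rest
    covers′ z∈ with covers z∈
    ... | inj₁ z∈kept          = inj₁ (kept⊆ z∈kept)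
    ... | inj₂ (here refl)     = inj₁ (∈-++⁺ʳ pre (here refl))
    ... | inj₂ (there z∈rest)  = inj₂ z∈rest

  -- The kept walk is base ++ pivot ∷ trail, where pivot is the last vertex seen for the first time;
  -- the segment pivot ∷ trail repeats no vertex, so every fresh vertex adds at most n to the length.
  record State (c : Fin n) (rest : List (Fin n)) : Set where
    constructor state
    field
      base trail fresh : List (Fin n)
      pivot            : Fin n
      prefix           : Prefix c rest (base ++ pivot ∷ trail)
      trail⊆base       : trail ⊆ base
      segment-unique   : Unique (pivot ∷ trail)
      fresh-unique     : Unique fresh
      fresh⊆kept       : fresh ⊆ base ++ pivot ∷ trail
      length-bound     : length base + n ≤ n * length fresh

  kept : ∀ {c rest} → State c rest → List (Fin n)
  kept s = State.base s ++ State.pivot s ∷ State.trail s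

  length-kept : ∀ {c rest} (s : State c rest) → length (kept s) ≤ n * length (State.fresh s)
  length-kept s = begin
    length (base ++ pivot ∷ trail)       ≡⟨ length-++ base ⟩
    length base + length (pivot ∷ trail) ≤⟨ +-monoʳ-≤ (length base) (Unique⇒length≤ segment-unique) ⟩
    length base + n                      ≤⟨ length-bound ⟩
    n * length fresh                     ∎
    where
    open State s
    open ≤-Reasoning

  drop-trail : ∀ {base trail : List (Fin n)} p ys → trail ⊆ base → base ++ p ∷ trail ⊆ base ++ p ∷ ys
  drop-trail {base} p ys trail⊆base z∈ with ∈-++⁻ base z∈
  ... | inj₁ z∈base               = ∈-++⁺ˡ z∈base
  ... | inj₂ (here refl)          = ∈-++⁺ʳ base (here refl)
  ... | inj₂ (there z∈trail)      = ∈-++⁺ˡ (trail⊆base z∈trail)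

  step-fresh : ∀ {c x rest} (s : State c (x ∷ rest)) → E G c x → x ∉ₗ kept s → State x rest
  step-fresh {x = x} s@(state _ _ fresh _ p _ _ fresh-u fresh⊆ _) e x∉ =
    state (kept s) [] (x ∷ fresh) x
      (prefix-step (kept s) [] p e refl (xs⊆xs++ys (kept s) [ x ])) (λ ())
      ([] ∷ []) (¬Any⇒All¬ fresh (x∉ ∘ fresh⊆) ∷ fresh-u)
      (λ { (here refl) → ∈-++⁺ʳ (kept s) (here refl) ; (there z∈) → ∈-++⁺ˡ (fresh⊆ z∈) })
      bound′
    where
    open ≤-Reasoning
    bound′ : length (kept s) + n ≤ n * length (x ∷ fresh)
    bound′ = begin
      length (kept s) + n    ≤⟨ +-monoˡ-≤ n (length-kept s) ⟩
      n * length fresh + n   ≡⟨ +-comm (n * length fresh) n ⟩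
      n + n * length fresh   ≡⟨ *-suc n (length fresh) ⟨
      n * length (x ∷ fresh) ∎

  step-seen : ∀ {c x rest} (s : State c (x ∷ rest)) → E G c x →
              x ∈ₗ kept s → x ∉ₗ State.pivot s ∷ State.trail s → State x rest
  step-seen {x = x} {rest} (state base trail fresh pivot p trail⊆ seg-u fresh-u fresh⊆ bound) e x∈ x∉seg =
    state base (trail ++ [ x ]) fresh pivot
      (subst (Prefix x rest) assoc (prefix-step (base ++ pivot ∷ trail) [] p e refl (xs⊆xs++ys _ [ x ])))
      trail′⊆ (Unique-∷ʳ seg-u x∉seg) fresh-u
      (λ z∈ → subst (_ ∈ₗ_) assoc (∈-++⁺ˡ (fresh⊆ z∈))) bound
    where
    assoc : (base ++ pivot ∷ trail) ++ [ x ] ≡ base ++ pivot ∷ trail ++ [ x ]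
    assoc = ++-assoc base (pivot ∷ trail) [ x ]
    x∈base : x ∈ₗ base
    x∈base with ∈-++⁻ base x∈
    ... | inj₁ x∈base = x∈base
    ... | inj₂ x∈seg  = ⊥-elim (x∉seg x∈seg)
    trail′⊆ : trail ++ [ x ] ⊆ base
    trail′⊆ z∈ with ∈-++⁻ trail z∈
    ... | inj₁ z∈trail    = trail⊆ z∈trail
    ... | inj₂ (here refl) = x∈base

  step-return-to-pivot : ∀ {c x rest} (s : State c (x ∷ rest)) → E G c x → x ≡ State.pivot s → State x rest
  step-return-to-pivot (state base trail fresh x p trail⊆ _ fresh-u fresh⊆ bound) e refl =
    state base [] fresh x
      (prefix-step base (trail ++ [ x ]) p e (++-assoc base (x ∷ trail) [ x ]) (drop-trail x [] trail⊆))
      (λ ()) ([] ∷ []) fresh-u (drop-trail x [] trail⊆ ∘ fresh⊆) bound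

  step-return-to-trail : ∀ {c x rest} (s : State c (x ∷ rest)) → E G c x → x ∈ₗ State.trail s → State x rest
  step-return-to-trail {x = x} {rest} (state base trail fresh pivot p trail⊆ seg-u fresh-u fresh⊆ bound) e x∈trail
    with ∈-∃++ x∈trail
  ... | ys , zs , refl =
    state base (ys ++ [ x ]) fresh pivot
      (subst (Prefix x rest) (++-assoc base (pivot ∷ ys) [ x ])
        (prefix-step (base ++ pivot ∷ ys) (zs ++ [ x ]) p e cut
          (subst (base ++ pivot ∷ ys ++ x ∷ zs ⊆_) (sym (++-assoc base (pivot ∷ ys) [ x ])) (drop-trail pivot (ys ++ [ x ]) trail⊆))))
      (trail⊆ ∘ subst (_ ∈ₗ_) (++-assoc ys [ x ] zs) ∘ xs⊆xs++ys (ys ++ [ x ]) zs)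
      (AllPairs-++⁻ˡ (pivot ∷ ys ++ [ x ]) (subst Unique (cong (pivot ∷_) (sym (++-assoc ys [ x ] zs))) seg-u))
      fresh-u (drop-trail pivot (ys ++ [ x ]) trail⊆ ∘ fresh⊆) bound
    where
    cut : (base ++ pivot ∷ ys ++ x ∷ zs) ++ [ x ] ≡ (base ++ pivot ∷ ys) ++ x ∷ zs ++ [ x ]
    cut = begin
      (base ++ pivot ∷ ys ++ x ∷ zs) ++ [ x ] ≡⟨ ++-assoc base (pivot ∷ ys ++ x ∷ zs) [ x ] ⟩
      base ++ pivot ∷ (ys ++ x ∷ zs) ++ [ x ] ≡⟨ cong (λ l → base ++ pivot ∷ l) (++-assoc ys (x ∷ zs) [ x ]) ⟩
      base ++ (pivot ∷ ys) ++ x ∷ zs ++ [ x ] ≡⟨ ++-assoc base (pivot ∷ ys) (x ∷ zs ++ [ x ]) ⟨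
      (base ++ pivot ∷ ys) ++ x ∷ zs ++ [ x ] ∎
      where open ≡-Reasoning

  step : ∀ {c x rest} → State c (x ∷ rest) → E G c x → State x rest
  step {x = x} s e with x ∈? kept s | x ≟ State.pivot s | x ∈? State.trail s
  ... | no x∉     | _        | _        = step-fresh s e x∉
  ... | yes _     | yes x≡p  | _        = step-return-to-pivot s e x≡p
  ... | yes _     | no _     | yes x∈tr = step-return-to-trail s e x∈tr
  ... | yes x∈    | no x≢p   | no x∉tr  = step-seen s e x∈ λ { (here x≡p) → x≢p x≡p ; (there x∈) → x∉tr x∈ }

  run : ∀ {c} rest → State c rest → Adjacent (c ∷ rest) → ∃[ c′ ] State c′ []
  run []         s _       = _ , s
  run (x ∷ rest) s (e ∷ l) = run rest (step s e) l

  initial : State t₀ ts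
  initial = state [] [] [ t₀ ] t₀
    (record { adjacent = [-] ; head-kept = refl ; last-kept = refl ; weight-bound = ≤-refl
            ; covers = λ { (here refl) → inj₁ (here refl) ; (there z∈) → inj₂ z∈ } ; last-T = refl })
    (λ ()) ([] ∷ []) ([] ∷ []) id (≤-reflexive (sym (*-identityʳ n)))

  compressed : Adjacent T → ∃[ c ] State c []
  compressed = run ts initial

module _ {n : ℕ} (G : Graph n) (ω : Weight n) where

  open Walks G ω

  shorten : ∀ {T} → Tour T → ∃[ T′ ] Tour T′ × length T′ ≤ n * n × W T′ ≤ W T
  shorten {[]}     ((((_ , ()) , _) , _) , _)
  shorten {t₀ ∷ ts} ((((_ , _) , adjacent-T) , (_ , refl , closed)) , covers-T) with Compression.compressed G ω t₀ ts adjacent-T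
  ... | c , s =
    kept s , ((((t₀ , head-kept) , adjacent) , (t₀ , head-kept , last-kept′)) , covered) ,
    ≤-trans (length-kept s) (*-monoʳ-≤ n (Unique⇒length≤ (State.fresh-unique s))) ,
    ≤-trans (m≤m+n (W (kept s)) 0) weight-bound
    where
    open Compression G ω t₀ ts
    open Prefix (State.prefix s)
    last-kept′ : last (kept s) ≡ just t₀
    last-kept′ = trans last-kept (trans (sym last-T) closed)
    covered : ∀ z → z ∈ₗ kept s
    covered z with covers (covers-T z)
    ... | inj₁ z∈ = z∈
    ... | inj₂ ()

  bounded-lists : ℕ → List (List (Fin n))
  bounded-lists zero    = [ [] ]
  bounded-lists (suc k) = [] ∷ concat (map (λ x → map (x ∷_) (bounded-lists k)) (allFin n))

  ∈-bounded-lists : ∀ k xs → length xs ≤ k → xs ∈ₗ bounded-lists k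
  ∈-bounded-lists zero    []       _         = here refl
  ∈-bounded-lists (suc k) []       _         = here refl
  ∈-bounded-lists (suc k) (x ∷ xs) (s≤s len) =
    there (∈-concat⁺′ (∈-map⁺ (x ∷_) (∈-bounded-lists k xs len)) (∈-map⁺ (λ y → map (y ∷_) (bounded-lists k)) (∈-allFin x)))

  adjacent? : ∀ xs → Dec (Adjacent xs)
  adjacent? []           = yes []
  adjacent? (_ ∷ [])     = yes [-]
  adjacent? (x ∷ y ∷ xs) with E? G x y | adjacent? (y ∷ xs)
  ... | yes e | yes l = yes (e ∷ l)
  ... | no ¬e | _     = no λ { (e ∷ _) → ¬e e }
  ... | yes _ | no ¬l = no λ { (_ ∷ l) → ¬l l }

  tour? : ∀ xs → Dec (Tour xs)
  tour? []       = no λ { ((((_ , ()) , _) , _) , _) }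
  tour? (x ∷ xs) with adjacent? (x ∷ xs) | last-∷ x xs | all-Fin? (λ v → v ∈? x ∷ xs)
  ... | no ¬l | _      | _     = no λ { (((_ , l) , _) , _) → ¬l l }
  ... | yes l | y , ly | no ¬c = no λ t → ¬c (proj₂ t)
  ... | yes l | y , ly | yes c with x ≟ y
  ...   | yes refl = yes ((((x , refl) , l) , (x , refl , ly)) , c)
  ...   | no x≢y   = no λ { ((_ , (_ , refl , lx)) , _) → x≢y (just-injective (trans (sym lx) ly)) }

  -- Every tour can be shortened to length at most n², so a lightest tour of that length is optimal.
  optimal-tour : (∃[ T ] Tour T) → ∃[ P ] IsOptimalTSPTour G ω P
  optimal-tour (T , tour-T) with shorten tour-T
  ... | T′ , tour-T′ , _ , _ = P , argmin-all W tour-T′ (all-filter tour? (bounded-lists (n * n))) , optimal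
    where
    candidates : List (List (Fin n))
    candidates = filter tour? (bounded-lists (n * n))
    P : List (Fin n)
    P = argmin W T′ candidates
    optimal : ∀ ws → Tour ws → W P ≤ W ws
    optimal ws tour-ws with shorten tour-ws
    ... | ws′ , tour-ws′ , len , W≤ = ≤-trans
      (All.lookup (f[argmin]≤f[xs] T′ candidates) (∈-filter⁺ tour? (∈-bounded-lists (n * n) ws′ len) tour-ws′)) W≤

  rotate : ∀ {P z} → Tour P → z ∈ₗ P → ∃[ R ] Tour R × W R ≡ W P × head R ≡ just z
  rotate {P} {z} tour-P z∈P with ∈-∃++ z∈P
  ... | []     , ys , refl = P , tour-P , refl , refl
  ... | a ∷ as , ys , refl with tour-P
  ...   | ((_ , adjacent-P) , (_ , refl , closed)) , covers-P with ∷-∷ʳ z ys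
  ...     | ds , a′ , z∷ys≡ with trans (sym (trans (cong last z∷ys≡) (last-∷ʳ ds a′))) (trans (sym (last-++-∷ (a ∷ as) z ys)) closed)
  ...       | refl = R , ((((z , starts) , adjacent-R) , (z , starts , ends)) , covers-R) , weight , starts
    where
    R : List (Fin n)
    R = ds ++ a ∷ as ++ [ z ]
    split : Adjacent ((a ∷ as) ++ [ z ]) × Adjacent (z ∷ ys)
    split = Linked-++-∷⁻ (a ∷ as) z ys adjacent-P
    adjacent-R : Adjacent R
    adjacent-R = Linked-++-∷⁺ ds a (as ++ [ z ]) (subst Adjacent z∷ys≡ (proj₂ split)) (proj₁ split)
    starts : head R ≡ just z
    starts = trans (head-++-∷ ds a (as ++ [ z ]) []) (cong head (sym z∷ys≡))
    ends : last R ≡ just z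
    ends = trans (last-++-∷ ds a (as ++ [ z ])) (last-∷ʳ (a ∷ as) z)
    weight : W R ≡ W (a ∷ as ++ z ∷ ys)
    weight = begin
      W R                                   ≡⟨ W-++-∷ ds a (as ++ [ z ]) ⟩
      W (ds ++ [ a ]) + W (a ∷ as ++ [ z ]) ≡⟨ cong (λ l → W l + W (a ∷ as ++ [ z ])) z∷ys≡ ⟨
      W (z ∷ ys) + W (a ∷ as ++ [ z ])      ≡⟨ +-comm (W (z ∷ ys)) _ ⟩
      W (a ∷ as ++ [ z ]) + W (z ∷ ys)      ≡⟨ W-++-∷ (a ∷ as) z ys ⟨
      W (a ∷ as ++ z ∷ ys)                  ∎
      where open ≡-Reasoning
    covers-R : ∀ y → y ∈ₗ R
    covers-R y with ∈-++⁻ (a ∷ as) (covers-P y)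
    ... | inj₁ (here refl)   = ∈-++⁺ʳ ds (here refl)
    ... | inj₁ (there y∈as)  = ∈-++⁺ʳ ds (there (∈-++⁺ˡ y∈as))
    ... | inj₂ y∈z∷ys with ∈-++⁻ ds (subst (y ∈ₗ_) z∷ys≡ y∈z∷ys)
    ...   | inj₁ y∈ds        = ∈-++⁺ˡ y∈ds
    ...   | inj₂ (here refl) = ∈-++⁺ʳ ds (here refl)

module Counting {n : ℕ} (G : Graph n) (ω : Weight n) where

  open Walks G ω

  Pred³ : Set₁
  Pred³ = Fin n → Fin n → Fin n → Set

  Decidable³ : Pred³ → Set
  Decidable³ φ = ∀ u y v → Dec (φ u y v)

  indicator : ∀ {A : Set} → Dec A → ℕ
  indicator (yes _) = 1
  indicator (no _)  = 0

  indicator-yes : ∀ {A : Set} (a? : Dec A) → A → indicator a? ≡ 1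
  indicator-yes (yes _) _ = refl
  indicator-yes (no ¬a) a = ⊥-elim (¬a a)

  indicator-no : ∀ {A : Set} (a? : Dec A) → ¬ A → indicator a? ≡ 0
  indicator-no (yes a) ¬a = ⊥-elim (¬a a)
  indicator-no (no _)  _  = refl

  indicator-mono : ∀ {A B : Set} (a? : Dec A) (b? : Dec B) → (A → B) → indicator a? ≤ indicator b?
  indicator-mono (yes a) (yes _) _ = ≤-refl
  indicator-mono (yes a) (no ¬b) f = ⊥-elim (¬b (f a))
  indicator-mono (no _)  _       _ = z≤n

  indicator-cong : ∀ {A B : Set} (a? : Dec A) (b? : Dec B) → (A → B) → (B → A) → indicator a? ≡ indicator b?
  indicator-cong a? b? f g = ≤-antisym (indicator-mono a? b? f) (indicator-mono b? a? g)

  module _ {φ : Pred³} (φ? : Decidable³ φ) where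

    count : List (Fin n) → ℕ
    count (u ∷ y ∷ v ∷ xs) = indicator (φ? u y v) + count (y ∷ v ∷ xs)
    count _                = 0

    count-++-∷ : ∀ xs c ys → (∀ u v → ¬ φ u c v) → count (xs ++ c ∷ ys) ≡ count (xs ++ [ c ]) + count (c ∷ ys)
    count-++-∷ []               c ys        ¬φ = refl
    count-++-∷ (a ∷ [])         c []        ¬φ = refl
    count-++-∷ (a ∷ [])         c (y ∷ ys)  ¬φ = cong (_+ count (c ∷ y ∷ ys)) (indicator-no (φ? a c y) (¬φ a y))
    count-++-∷ (a ∷ b ∷ [])     c ys        ¬φ =
      trans (cong (indicator (φ? a b c) +_) (count-++-∷ (b ∷ []) c ys ¬φ)) (sym (+-assoc (indicator (φ? a b c)) _ _))
    count-++-∷ (a ∷ b ∷ d ∷ xs) c ys        ¬φ =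
      trans (cong (indicator (φ? a b d) +_) (count-++-∷ (b ∷ d ∷ xs) c ys ¬φ)) (sym (+-assoc (indicator (φ? a b d)) _ _))

    count-∷ʳ : ∀ xs a b c → count ((xs ++ a ∷ [ b ]) ++ [ c ]) ≡ count (xs ++ a ∷ [ b ]) + indicator (φ? a b c)
    count-∷ʳ []               a b c = +-comm (indicator (φ? a b c)) 0
    count-∷ʳ (x ∷ [])         a b c =
      trans (cong (indicator (φ? x a b) +_) (count-∷ʳ [] a b c)) (sym (+-assoc (indicator (φ? x a b)) _ _))
    count-∷ʳ (x ∷ y ∷ [])     a b c =
      trans (cong (indicator (φ? x y a) +_) (count-∷ʳ (y ∷ []) a b c)) (sym (+-assoc (indicator (φ? x y a)) _ _))
    count-∷ʳ (x ∷ y ∷ z ∷ xs) a b c =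
      trans (cong (indicator (φ? x y z) +_) (count-∷ʳ (y ∷ z ∷ xs) a b c)) (sym (+-assoc (indicator (φ? x y z)) _ _))

    count-reverse : (∀ {u y v} → φ u y v → φ v y u) → ∀ xs → count (reverse xs) ≡ count xs
    count-reverse φ-sym []               = refl
    count-reverse φ-sym (_ ∷ [])         = refl
    count-reverse φ-sym (_ ∷ _ ∷ [])     = refl
    count-reverse φ-sym (x ∷ y ∷ z ∷ xs) = begin
      count (reverse (x ∷ y ∷ z ∷ xs))
        ≡⟨ cong count (trans (unfold-reverse x (y ∷ z ∷ xs)) (cong (_∷ʳ x) (reverse-∷-∷ y z xs))) ⟩
      count (((reverse xs ∷ʳ z) ∷ʳ y) ∷ʳ x)
        ≡⟨ cong count (cong (_∷ʳ x) (++-assoc (reverse xs) [ z ] [ y ])) ⟩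
      count ((reverse xs ++ z ∷ [ y ]) ∷ʳ x)
        ≡⟨ count-∷ʳ (reverse xs) z y x ⟩
      count (reverse xs ++ z ∷ [ y ]) + indicator (φ? z y x)
        ≡⟨ cong₂ _+_ (cong count (trans (sym (++-assoc (reverse xs) [ z ] [ y ])) (sym (reverse-∷-∷ y z xs))))
                     (indicator-cong (φ? z y x) (φ? x y z) φ-sym φ-sym) ⟩
      count (reverse (y ∷ z ∷ xs)) + indicator (φ? x y z)
        ≡⟨ cong (_+ indicator (φ? x y z)) (count-reverse φ-sym (y ∷ z ∷ xs)) ⟩
      count (y ∷ z ∷ xs) + indicator (φ? x y z)
        ≡⟨ +-comm _ (indicator (φ? x y z)) ⟩
      count (x ∷ y ∷ z ∷ xs)
        ∎
      where open ≡-Reasoning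

    triple⇒count>0 : ∀ {u y v xs} → Triple u y v xs → φ u y v → 0 < count xs
    triple⇒count>0 {u} {y} {v} here p rewrite indicator-yes (φ? u y v) p = s≤s z≤n
    triple⇒count>0 {xs = a ∷ b ∷ c ∷ _} (there t) p = ≤-trans (triple⇒count>0 t p) (m≤n+m _ (indicator (φ? a b c)))
    triple⇒count>0 {xs = _ ∷ []} (there ()) p
    triple⇒count>0 {xs = _ ∷ _ ∷ []} (there (there ())) p

    count>0⇒triple : ∀ xs → 0 < count xs → ∃[ u ] ∃[ y ] ∃[ v ] Triple u y v xs × φ u y v
    count>0⇒triple (a ∷ b ∷ c ∷ xs) pos = first-or-later (φ? a b c) pos (count>0⇒triple (b ∷ c ∷ xs))
      where
      first-or-later : (p? : Dec (φ a b c)) → 0 < indicator p? + count (b ∷ c ∷ xs) →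
                       (0 < count (b ∷ c ∷ xs) → ∃[ u ] ∃[ y ] ∃[ v ] Triple u y v (b ∷ c ∷ xs) × φ u y v) →
                       ∃[ u ] ∃[ y ] ∃[ v ] Triple u y v (a ∷ b ∷ c ∷ xs) × φ u y v
      first-or-later (yes p) _    _     = a , b , c , here , p
      first-or-later (no _)  pos′ later with later pos′
      ... | u , y , v , t , p = u , y , v , there t , p
    count>0⇒triple []           ()
    count>0⇒triple (_ ∷ [])     ()
    count>0⇒triple (_ ∷ _ ∷ []) ()

  module _ {φ ψ : Pred³} (φ? : Decidable³ φ) (ψ? : Decidable³ ψ) (φ⇒ψ : ∀ u y v → φ u y v → ψ u y v) where

    count-mono : ∀ xs → count φ? xs ≤ count ψ? xs
    count-mono (a ∷ b ∷ c ∷ xs) = +-mono-≤ (indicator-mono (φ? a b c) (ψ? a b c) (φ⇒ψ a b c)) (count-mono (b ∷ c ∷ xs))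
    count-mono []               = z≤n
    count-mono (_ ∷ [])         = z≤n
    count-mono (_ ∷ _ ∷ [])     = z≤n

    count-mono-< : ∀ {u y v} xs → Triple u y v xs → ψ u y v → ¬ φ u y v → count φ? xs < count ψ? xs
    count-mono-< {u} {y} {v} (_ ∷ _ ∷ _ ∷ xs) here p ¬p
      rewrite indicator-yes (ψ? u y v) p | indicator-no (φ? u y v) ¬p = s≤s (count-mono (y ∷ v ∷ xs))
    count-mono-< (a ∷ b ∷ c ∷ xs) (there t) p ¬p =
      +-mono-≤-< (indicator-mono (φ? a b c) (ψ? a b c) (φ⇒ψ a b c)) (count-mono-< (b ∷ c ∷ xs) t p ¬p)
    count-mono-< (_ ∷ [])     (there ()) p ¬p
    count-mono-< (_ ∷ _ ∷ []) (there (there ())) p ¬p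

-- The hop graph and surgery on closed walks

module HopGraph {n : ℕ} (G : Graph n) (ω : Weight n) (ω-sym : Symmetric ω)
                (C : Subset n) (cover : IsVertexCover G ω C) where

  open Walks G ω
  open Counting G ω

  neighbour∈C : ∀ {u y} → y ∉ C → E G u y → u ∈ C
  neighbour∈C {u} {y} y∉C e with cover u y e
  ... | inj₁ u∈C = u∈C
  ... | inj₂ y∈C = ⊥-elim (y∉C y∈C)

  minList-≤ : ∀ {z} xs → z ∈ₗ xs → minList G ω xs ≤ z
  minList-≤ {z} (x ∷ xs) z∈ = foldr-preservesᵒ (λ a b → [ m≤n⇒m⊓o≤n b , m≤n⇒o⊓m≤n a ]′) x xs (at z∈)
    where
    at : z ∈ₗ x ∷ xs → x ≤ z ⊎ Any (_≤ z) xs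
    at (here refl)  = inj₁ ≤-refl
    at (there z∈xs) = inj₂ (Any.map (λ { refl → ≤-refl }) z∈xs)

  minList-attained : ∀ (f : Fin n → ℕ) {w} ys → w ∈ₗ ys → ∃[ w′ ] w′ ∈ₗ ys × minList G ω (map f ys) ≡ f w′
  minList-attained f (y ∷ ys) _ = ∈-map⁻ f (minimum∈ (foldr-selective ⊓-sel (f y) (map f ys)))
    where
    minimum∈ : ∀ {m} → m ≡ f y ⊎ m ∈ₗ map f ys → m ∈ₗ map f (y ∷ ys)
    minimum∈ (inj₁ m≡) = here m≡
    minimum∈ (inj₂ m∈) = there m∈

  ∈-neighbours : ∀ {s w} → E G s w → w ∈ₗ filter (E? G s) (allFin n)
  ∈-neighbours {s} {w} e = ∈-filter⁺ (E? G s) (∈-allFin w) e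

  ω-min : Fin n → ℕ
  ω-min = ωmin G ω

  ω-min≤ω : ∀ {s w} → E G s w → ω-min s ≤ ω s w
  ω-min≤ω {s} e = minList-≤ _ (∈-map⁺ (ω s) (∈-neighbours e))

  ω-min-attained : ∀ {s w} → E G s w → ∃[ w′ ] E G s w′ × ω s w′ ≡ ω-min s
  ω-min-attained {s} e with minList-attained (ω s) (filter (E? G s) (allFin n)) (∈-neighbours e)
  ... | w′ , w′∈ , eq = w′ , proj₂ (∈-filter⁻ (E? G s) {xs = allFin n} w′∈) , sym eq

  loop≤hop : ∀ {u y v} → E G u y → E G y v → 2 * ω-min y ≤ ω u y + ω y v
  loop≤hop {u} {y} {v} e₁ e₂ = begin
    2 * ω-min y       ≡⟨ cong (ω-min y +_) (+-identityʳ (ω-min y)) ⟩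
    ω-min y + ω-min y ≤⟨ +-mono-≤ (subst (ω-min y ≤_) (ω-sym y u) (ω-min≤ω (E-sym G e₁))) (ω-min≤ω e₂) ⟩
    ω u y + ω y v     ∎
    where open ≤-Reasoning

  -- The truncated subtraction in hcost never cuts off, by loop≤hop.
  hop-cost : ∀ {u y v} → E G u y → E G y v → hcost G ω (u , v , y) + 2 * ω-min y ≡ ω u y + ω y v
  hop-cost e₁ e₂ = m∸n+n≡m (loop≤hop e₁ e₂)

  cheapest-loop : ∀ {s w} → ω s w ≡ ω-min s → ω w s + ω s w ≡ 2 * ω-min s
  cheapest-loop {s} {w} eq = trans (cong₂ _+_ (trans (ω-sym w s) eq) eq) (cong (ω-min s +_) (sym (+-identityʳ (ω-min s))))

  IsHop : Pred³
  IsHop u y v = y ∉ C × u ≢ v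

  hop? : Decidable³ IsHop
  hop? u y v = ¬? (y Subset.∈? C) ×-dec ¬? (u ≟ v)

  HopLike : Pred³ → Set
  HopLike φ = ∀ {u y v} → φ u y v → IsHop u y v

  Reversible : Pred³ → Set
  Reversible φ = ∀ {u y v} → φ u y v → φ v y u

  not-middle : ∀ {φ} → HopLike φ → ∀ {c} → c ∈ C → ∀ u v → ¬ φ u c v
  not-middle hop-like c∈C u v p = proj₁ (hop-like p) c∈C

  not-loop : ∀ {φ} → HopLike φ → ∀ u y → ¬ φ u y u
  not-loop hop-like u y p = proj₂ (hop-like p) refl

  W-around : ∀ xs u a v ys → W (xs ++ u ∷ a ∷ v ∷ ys) ≡ W (xs ++ [ u ]) + (ω u a + ω a v) + W (v ∷ ys)
  W-around xs u a v ys = begin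
    W (xs ++ u ∷ a ∷ v ∷ ys)                         ≡⟨ W-++-∷ xs u (a ∷ v ∷ ys) ⟩
    W (xs ++ [ u ]) + (ω u a + (ω a v + W (v ∷ ys))) ≡⟨ cong (W (xs ++ [ u ]) +_) (+-assoc (ω u a) (ω a v) _) ⟨
    W (xs ++ [ u ]) + (ω u a + ω a v + W (v ∷ ys))   ≡⟨ +-assoc (W (xs ++ [ u ])) _ _ ⟨
    W (xs ++ [ u ]) + (ω u a + ω a v) + W (v ∷ ys)   ∎
    where open ≡-Reasoning

  module _ {φ : Pred³} (φ? : Decidable³ φ) (hop-like : HopLike φ) where

    count-around : ∀ xs {u} a {v} ys → u ∈ C → v ∈ C →
                   count φ? (xs ++ u ∷ a ∷ v ∷ ys) ≡ count φ? (xs ++ [ u ]) + indicator (φ? u a v) + count φ? (v ∷ ys)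
    count-around xs {u} a {v} ys u∈C v∈C = begin
      count φ? (xs ++ u ∷ a ∷ v ∷ ys)
        ≡⟨ count-++-∷ φ? xs u (a ∷ v ∷ ys) (not-middle hop-like u∈C) ⟩
      count φ? (xs ++ [ u ]) + (indicator (φ? u a v) + count φ? (a ∷ v ∷ ys))
        ≡⟨ cong (λ k → count φ? (xs ++ [ u ]) + (indicator (φ? u a v) + k)) (count-++-∷ φ? [ a ] v ys (not-middle hop-like v∈C)) ⟩
      count φ? (xs ++ [ u ]) + (indicator (φ? u a v) + count φ? (v ∷ ys))
        ≡⟨ +-assoc (count φ? (xs ++ [ u ])) _ _ ⟨
      count φ? (xs ++ [ u ]) + indicator (φ? u a v) + count φ? (v ∷ ys) ∎
      where open ≡-Reasoning

  record ClosedAt (c₀ : Fin n) (P : List (Fin n)) : Set where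
    field
      adjacent : Adjacent P
      starts   : head P ≡ just c₀
      ends     : last P ≡ just c₀

  ClosedAt-resp : ∀ {c₀ P Q} → ClosedAt c₀ P → Adjacent Q → head Q ≡ head P → last Q ≡ last P → ClosedAt c₀ Q
  ClosedAt-resp cl l h e = record { adjacent = l ; starts = trans h starts ; ends = trans e ends }
    where open ClosedAt cl

  module ReplaceMiddle (xs ys : List (Fin n)) (u a b v : Fin n) where

    before after : List (Fin n)
    before = xs ++ u ∷ a ∷ v ∷ ys
    after  = xs ++ u ∷ b ∷ v ∷ ys

    closed-after : ∀ {c₀} → ClosedAt c₀ before → E G u b → E G b v → ClosedAt c₀ after
    closed-after cl e₁ e₂ with Linked-++-∷⁻ xs u (a ∷ v ∷ ys) (ClosedAt.adjacent cl)
    ... | l₁ , _ ∷ _ ∷ l₂ = ClosedAt-resp cl (Linked-++-∷⁺ xs u (b ∷ v ∷ ys) l₁ (e₁ ∷ e₂ ∷ l₂))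
      (head-++-∷ xs u (b ∷ v ∷ ys) (a ∷ v ∷ ys)) (trans (last-++-∷ xs u _) (sym (last-++-∷ xs u _)))

    weight : W after + (ω u a + ω a v) ≡ W before + (ω u b + ω b v)
    weight = begin
      W after + (ω u a + ω a v)                                        ≡⟨ cong (_+ (ω u a + ω a v)) (W-around xs u b v ys) ⟩
      W (xs ++ [ u ]) + (ω u b + ω b v) + W (v ∷ ys) + (ω u a + ω a v) ≡⟨ +-swap₂₄ (W (xs ++ [ u ])) _ _ _ ⟩
      W (xs ++ [ u ]) + (ω u a + ω a v) + W (v ∷ ys) + (ω u b + ω b v) ≡⟨ cong (_+ (ω u b + ω b v)) (W-around xs u a v ys) ⟨
      W before + (ω u b + ω b v)                                       ∎
      where open ≡-Reasoning

    count-exchange : ∀ {φ} (φ? : Decidable³ φ) → HopLike φ → u ∈ C → v ∈ C →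
                     count φ? after + indicator (φ? u a v) ≡ count φ? before + indicator (φ? u b v)
    count-exchange φ? hop-like u∈C v∈C = begin
      count φ? after + indicator (φ? u a v)
        ≡⟨ cong (_+ indicator (φ? u a v)) (count-around φ? hop-like xs b ys u∈C v∈C) ⟩
      count φ? (xs ++ [ u ]) + indicator (φ? u b v) + count φ? (v ∷ ys) + indicator (φ? u a v)
        ≡⟨ +-swap₂₄ (count φ? (xs ++ [ u ])) _ _ _ ⟩
      count φ? (xs ++ [ u ]) + indicator (φ? u a v) + count φ? (v ∷ ys) + indicator (φ? u b v)
        ≡⟨ cong (_+ indicator (φ? u b v)) (count-around φ? hop-like xs a ys u∈C v∈C) ⟨
      count φ? before + indicator (φ? u b v) ∎
      where open ≡-Reasoning

    ∈-after : ∀ {z} → z ∈ₗ before → z ≢ a → z ∈ₗ after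
    ∈-after z∈ z≢a with ∈-++⁻ xs z∈
    ... | inj₁ z∈xs                     = ∈-++⁺ˡ z∈xs
    ... | inj₂ (here refl)              = ∈-++⁺ʳ xs (here refl)
    ... | inj₂ (there (here refl))      = ⊥-elim (z≢a refl)
    ... | inj₂ (there (there z∈))       = ∈-++⁺ʳ xs (there (there z∈))

    triple-after : Triple u b v after
    triple-after = split⇒triple xs ys

    -- The other triples through a have a as an end, and a ∉ C.
    triple-preserved : a ∉ C → ∀ {u′ y v′} → u′ ∈ C → v′ ∈ C → ¬ (u′ ≡ u × y ≡ a × v′ ≡ v) →
                       Triple u′ y v′ before → Triple u′ y v′ after
    triple-preserved a∉C {u′} {y} {v′} u′∈C v′∈C ¬same = go xs
      where
      go : ∀ xs → Triple u′ y v′ (xs ++ u ∷ a ∷ v ∷ ys) → Triple u′ y v′ (xs ++ u ∷ b ∷ v ∷ ys)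
      go []               here                = ⊥-elim (¬same (refl , refl , refl))
      go []               (there here)        = ⊥-elim (a∉C u′∈C)
      go []               (there (there t))   = there (there t)
      go (_ ∷ [])         here                = ⊥-elim (a∉C v′∈C)
      go (_ ∷ _ ∷ [])     here                = here
      go (_ ∷ _ ∷ _ ∷ xs) here                = here
      go (_ ∷ xs)         (there t)           = there (go xs t)

  module Loop (xs ys : List (Fin n)) (u f : Fin n) where

    with-loop without-loop : List (Fin n)
    with-loop    = xs ++ u ∷ f ∷ u ∷ ys
    without-loop = xs ++ u ∷ ys

    closed-without : ∀ {c₀} → ClosedAt c₀ with-loop → ClosedAt c₀ without-loop
    closed-without cl with Linked-++-∷⁻ xs u (f ∷ u ∷ ys) (ClosedAt.adjacent cl)
    ... | l₁ , _ ∷ _ ∷ l₂ = ClosedAt-resp cl (Linked-++-∷⁺ xs u ys l₁ l₂)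
      (head-++-∷ xs u ys (f ∷ u ∷ ys)) (trans (last-++-∷ xs u ys) (sym (last-++-∷ xs u (f ∷ u ∷ ys))))

    closed-with : ∀ {c₀} → ClosedAt c₀ without-loop → E G u f → ClosedAt c₀ with-loop
    closed-with cl e with Linked-++-∷⁻ xs u ys (ClosedAt.adjacent cl)
    ... | l₁ , l₂ = ClosedAt-resp cl (Linked-++-∷⁺ xs u (f ∷ u ∷ ys) l₁ (e ∷ E-sym G e ∷ l₂))
      (head-++-∷ xs u (f ∷ u ∷ ys) ys) (trans (last-++-∷ xs u (f ∷ u ∷ ys)) (sym (last-++-∷ xs u ys)))

    weight : W with-loop ≡ W without-loop + (ω u f + ω f u)
    weight = begin
      W with-loop                                    ≡⟨ W-around xs u f u ys ⟩
      W (xs ++ [ u ]) + (ω u f + ω f u) + W (u ∷ ys) ≡⟨ +-swap₂₃ (W (xs ++ [ u ])) _ _ ⟩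
      W (xs ++ [ u ]) + W (u ∷ ys) + (ω u f + ω f u) ≡⟨ cong (_+ (ω u f + ω f u)) (W-++-∷ xs u ys) ⟨
      W without-loop + (ω u f + ω f u)               ∎
      where open ≡-Reasoning

    count-loop : ∀ {φ} (φ? : Decidable³ φ) → HopLike φ → u ∈ C → count φ? with-loop ≡ count φ? without-loop
    count-loop φ? hop-like u∈C = begin
      count φ? with-loop
        ≡⟨ count-around φ? hop-like xs f ys u∈C u∈C ⟩
      count φ? (xs ++ [ u ]) + indicator (φ? u f u) + count φ? (u ∷ ys)
        ≡⟨ cong (λ k → count φ? (xs ++ [ u ]) + k + count φ? (u ∷ ys)) (indicator-no (φ? u f u) (not-loop hop-like u f)) ⟩
      count φ? (xs ++ [ u ]) + 0 + count φ? (u ∷ ys)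
        ≡⟨ cong (_+ count φ? (u ∷ ys)) (+-identityʳ _) ⟩
      count φ? (xs ++ [ u ]) + count φ? (u ∷ ys)
        ≡⟨ count-++-∷ φ? xs u ys (not-middle hop-like u∈C) ⟨
      count φ? without-loop
        ∎
      where open ≡-Reasoning

    ∈-without : ∀ {z} → z ∈ₗ with-loop → z ≢ f → z ∈ₗ without-loop
    ∈-without z∈ z≢f with ∈-++⁻ xs z∈
    ... | inj₁ z∈xs                = ∈-++⁺ˡ z∈xs
    ... | inj₂ (here refl)         = ∈-++⁺ʳ xs (here refl)
    ... | inj₂ (there (here refl)) = ⊥-elim (z≢f refl)
    ... | inj₂ (there (there z∈))  = ∈-++⁺ʳ xs z∈

    ∈-with : without-loop ⊆ with-loop
    ∈-with z∈ with ∈-++⁻ xs z∈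
    ... | inj₁ z∈xs        = ∈-++⁺ˡ z∈xs
    ... | inj₂ (here refl) = ∈-++⁺ʳ xs (here refl)
    ... | inj₂ (there z∈)  = ∈-++⁺ʳ xs (there (there (there z∈)))

    f∈with : f ∈ₗ with-loop
    f∈with = ∈-++⁺ʳ xs (there (here refl))

    hop-preserved : u ∈ C → ∀ {u′ y v′} → y ∉ C → u′ ≢ v′ → Triple u′ y v′ with-loop → Triple u′ y v′ without-loop
    hop-preserved u∈C {u′} {y} {v′} y∉C u′≢v′ = go xs
      where
      go : ∀ xs → Triple u′ y v′ (xs ++ u ∷ f ∷ u ∷ ys) → Triple u′ y v′ (xs ++ u ∷ ys)
      go []               here              = ⊥-elim (u′≢v′ refl)
      go []               (there here)      = ⊥-elim (y∉C u∈C)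
      go []               (there (there t)) = t
      go (_ ∷ [])         here              = ⊥-elim (y∉C u∈C)
      go (_ ∷ _ ∷ [])     here              = here
      go (_ ∷ _ ∷ _ ∷ xs) here              = here
      go (_ ∷ xs)         (there t)         = there (go xs t)

  -- Both hops u x v and u y v are cut out; the walk v … u between them is then traversed backwards.
  module ParallelHops (xs mid ys : List (Fin n)) (u x y v : Fin n) where

    before after : List (Fin n)
    before = xs ++ u ∷ x ∷ v ∷ (mid ++ u ∷ y ∷ v ∷ ys)
    after  = xs ++ u ∷ (reverse mid ++ v ∷ ys)

    reverse-between : reverse (v ∷ mid ++ [ u ]) ≡ (u ∷ reverse mid) ++ [ v ]
    reverse-between = trans (unfold-reverse v (mid ++ [ u ])) (cong (_∷ʳ v) (reverse-++ mid [ u ]))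

    closed-after : ∀ {c₀} → ClosedAt c₀ before → ClosedAt c₀ after
    closed-after cl with Linked-++-∷⁻ xs u (x ∷ v ∷ _) (ClosedAt.adjacent cl)
    ... | l₁ , _ ∷ _ ∷ l₂ with Linked-++-∷⁻ (v ∷ mid) u (y ∷ v ∷ ys) l₂
    ...   | l₃ , _ ∷ _ ∷ l₄ =
      ClosedAt-resp cl
        (Linked-++-∷⁺ xs u (reverse mid ++ v ∷ ys) l₁
          (Linked-++-∷⁺ (u ∷ reverse mid) v ys (subst Adjacent reverse-between (Linked-reverse (E-sym G) _ l₃)) l₄))
        (head-++-∷ xs u _ _) last-eq
      where
      last-eq : last after ≡ last before
      last-eq = begin
        last after                         ≡⟨ last-++-∷ xs u (reverse mid ++ v ∷ ys) ⟩
        last ((u ∷ reverse mid) ++ v ∷ ys) ≡⟨ last-++-∷ (u ∷ reverse mid) v ys ⟩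
        last (v ∷ ys)                      ≡⟨ last-++-∷ (v ∷ mid) u (y ∷ v ∷ ys) ⟨
        last (v ∷ mid ++ u ∷ y ∷ v ∷ ys)   ≡⟨ last-++-∷ xs u (x ∷ v ∷ _) ⟨
        last before                        ∎
        where open ≡-Reasoning

    weight : W before ≡ W after + ((ω u x + ω x v) + (ω u y + ω y v))
    weight = begin
      W before
        ≡⟨ W-around xs u x v _ ⟩
      W (xs ++ [ u ]) + hx + W (v ∷ mid ++ u ∷ y ∷ v ∷ ys)
        ≡⟨ cong (W (xs ++ [ u ]) + hx +_) (W-around (v ∷ mid) u y v ys) ⟩
      W (xs ++ [ u ]) + hx + (W back + hy + W (v ∷ ys))
        ≡⟨ +-pull-out (W (xs ++ [ u ])) hx (W back) hy (W (v ∷ ys)) ⟩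
      W (xs ++ [ u ]) + (W back + W (v ∷ ys)) + (hx + hy)
        ≡⟨ cong (λ k → W (xs ++ [ u ]) + (k + W (v ∷ ys)) + (hx + hy)) forth≡back ⟨
      W (xs ++ [ u ]) + (W forth + W (v ∷ ys)) + (hx + hy)
        ≡⟨ cong (λ k → W (xs ++ [ u ]) + k + (hx + hy)) (W-++-∷ (u ∷ reverse mid) v ys) ⟨
      W (xs ++ [ u ]) + W (u ∷ reverse mid ++ v ∷ ys) + (hx + hy)
        ≡⟨ cong (_+ (hx + hy)) (W-++-∷ xs u (reverse mid ++ v ∷ ys)) ⟨
      W after + (hx + hy)
        ∎
      where
      open ≡-Reasoning
      hx hy : ℕ
      hx = ω u x + ω x v
      hy = ω u y + ω y v
      back forth : List (Fin n)
      back = v ∷ mid ++ [ u ]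
      forth = (u ∷ reverse mid) ++ [ v ]
      forth≡back : W forth ≡ W back
      forth≡back = trans (cong W (sym reverse-between)) (W-reverse ω-sym back)

    count-drop : ∀ {φ} (φ? : Decidable³ φ) → HopLike φ → Reversible φ → u ∈ C → v ∈ C →
                 count φ? before ≡ count φ? after + (indicator (φ? u x v) + indicator (φ? u y v))
    count-drop φ? hop-like reversible u∈C v∈C = begin
      K before
        ≡⟨ count-around φ? hop-like xs x _ u∈C v∈C ⟩
      K (xs ++ [ u ]) + ix + K (v ∷ mid ++ u ∷ y ∷ v ∷ ys)
        ≡⟨ cong (K (xs ++ [ u ]) + ix +_) (count-around φ? hop-like (v ∷ mid) y ys u∈C v∈C) ⟩
      K (xs ++ [ u ]) + ix + (K back + iy + K (v ∷ ys))
        ≡⟨ +-pull-out (K (xs ++ [ u ])) ix (K back) iy (K (v ∷ ys)) ⟩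
      K (xs ++ [ u ]) + (K back + K (v ∷ ys)) + (ix + iy)
        ≡⟨ cong (λ k → K (xs ++ [ u ]) + (k + K (v ∷ ys)) + (ix + iy)) forth≡back ⟨
      K (xs ++ [ u ]) + (K forth + K (v ∷ ys)) + (ix + iy)
        ≡⟨ cong (λ k → K (xs ++ [ u ]) + k + (ix + iy)) (count-++-∷ φ? (u ∷ reverse mid) v ys (not-middle hop-like v∈C)) ⟨
      K (xs ++ [ u ]) + K (u ∷ reverse mid ++ v ∷ ys) + (ix + iy)
        ≡⟨ cong (_+ (ix + iy)) (count-++-∷ φ? xs u (reverse mid ++ v ∷ ys) (not-middle hop-like u∈C)) ⟨
      K after + (ix + iy)
        ∎
      where
      open ≡-Reasoning
      K : List (Fin n) → ℕ
      K = count φ?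
      ix iy : ℕ
      ix = indicator (φ? u x v)
      iy = indicator (φ? u y v)
      back forth : List (Fin n)
      back = v ∷ mid ++ [ u ]
      forth = (u ∷ reverse mid) ++ [ v ]
      forth≡back : K forth ≡ K back
      forth≡back = trans (cong K (sym reverse-between)) (count-reverse φ? reversible back)

    ∈-after : ∀ {z} → z ∈ₗ before → z ≢ x → z ≢ y → z ∈ₗ after
    ∈-after z∈ z≢x z≢y with ∈-++⁻ xs z∈
    ... | inj₁ z∈xs                            = ∈-++⁺ˡ z∈xs
    ... | inj₂ (here refl)                     = ∈-++⁺ʳ xs (here refl)
    ... | inj₂ (there (here refl))             = ⊥-elim (z≢x refl)
    ... | inj₂ (there (there (here refl)))     = ∈-++⁺ʳ xs (there (∈-++⁺ʳ (reverse mid) (here refl)))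
    ... | inj₂ (there (there (there z∈))) with ∈-++⁻ mid z∈
    ...   | inj₁ z∈mid                        = ∈-++⁺ʳ xs (there (∈-++⁺ˡ (reverse⁺ z∈mid)))
    ...   | inj₂ (here refl)                  = ∈-++⁺ʳ xs (here refl)
    ...   | inj₂ (there (here refl))          = ⊥-elim (z≢y refl)
    ...   | inj₂ (there (there z∈ys))         = ∈-++⁺ʳ xs (there (∈-++⁺ʳ (reverse mid) z∈ys))

  parallel-hops : ∀ {u v a b} P → u ∈ C → a ∉ C → b ∉ C → u ≢ v → a ≢ b → Triple u a v P → Triple u b v P →
                  ∃[ xs ] ∃[ mid ] ∃[ ys ] ∃[ x ] ∃[ y ] P ≡ xs ++ u ∷ x ∷ v ∷ (mid ++ u ∷ y ∷ v ∷ ys) × x ∉ C × y ∉ C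
  parallel-hops _ u∈C a∉C b∉C u≢v a≢b here here                       = ⊥-elim (a≢b refl)
  parallel-hops _ u∈C a∉C b∉C u≢v a≢b here (there here)               = ⊥-elim (a∉C u∈C)
  parallel-hops _ u∈C a∉C b∉C u≢v a≢b here (there (there here))       = ⊥-elim (u≢v refl)
  parallel-hops _ u∈C a∉C b∉C u≢v a≢b here (there (there (there t))) with triple⇒split t
  ... | mid , ys , refl = [] , mid , ys , _ , _ , refl , a∉C , b∉C
  parallel-hops _ u∈C a∉C b∉C u≢v a≢b (there here) here               = ⊥-elim (b∉C u∈C)
  parallel-hops _ u∈C a∉C b∉C u≢v a≢b (there (there here)) here       = ⊥-elim (u≢v refl)
  parallel-hops _ u∈C a∉C b∉C u≢v a≢b (there (there (there t))) here with triple⇒split t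
  ... | mid , ys , refl = [] , mid , ys , _ , _ , refl , b∉C , a∉C
  parallel-hops (z ∷ P) u∈C a∉C b∉C u≢v a≢b (there t₁) (there t₂) with parallel-hops P u∈C a∉C b∉C u≢v a≢b t₁ t₂
  ... | xs , mid , ys , x , y , refl , x∉C , y∉C = z ∷ xs , mid , ys , x , y , refl , x∉C , y∉C

module Matchings {n : ℕ} (G : Graph n) (ω : Weight n) (C : Subset n) where

  Edge : Set
  Edge = Fin n × Fin n × Fin n

  Apart : Edge → Edge → Set
  Apart e f = xPart G ω e ≢ xPart G ω f × yPart G ω e ≢ yPart G ω f

  Matching : List Edge → Set
  Matching = IsMatching G ω C

  Matched : List Edge → Fin n → Set
  Matched = MatchedBy G ω

  cost : List Edge → ℕ
  cost = matchingCost G ω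

  matched? : ∀ M y → Dec (Matched M y)
  matched? M y = map′ find (λ (_ , e∈ , eq) → lose e∈ eq) (Any.any? (λ e → yPart G ω e ≟ y) M)

  _≟₂_ : (p q : Fin n × Fin n) → Dec (p ≡ q)
  _≟₂_ = ≡-dec _≟_ _≟_

  pair-matched? : ∀ (M : List Edge) u v → (∃[ t ] (u , v , t) ∈ₗ M) ⊎ (∀ t → (u , v , t) ∉ₗ M)
  pair-matched? M u v with Any.any? (λ e → xPart G ω e ≟₂ (u , v)) M
  ... | no ¬found = inj₂ λ t e∈ → ¬found (lose e∈ refl)
  ... | yes found with find found
  ...   | (_ , _ , t) , e∈ , refl = inj₁ (t , e∈)

  cost-++-∷ : ∀ M₁ e M₂ → cost (M₁ ++ e ∷ M₂) ≡ cost M₁ + (hcost G ω e + cost M₂)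
  cost-++-∷ []       e M₂ = refl
  cost-++-∷ (g ∷ M₁) e M₂ = trans (cong (hcost G ω g +_) (cost-++-∷ M₁ e M₂)) (sym (+-assoc (hcost G ω g) _ _))

  cost-swap : ∀ M₁ e e′ M₂ → cost (M₁ ++ e′ ∷ M₂) + hcost G ω e ≡ cost (M₁ ++ e ∷ M₂) + hcost G ω e′
  cost-swap M₁ e e′ M₂ = begin
    cost (M₁ ++ e′ ∷ M₂) + hcost G ω e               ≡⟨ cong (_+ hcost G ω e) (cost-++-∷ M₁ e′ M₂) ⟩
    cost M₁ + (hcost G ω e′ + cost M₂) + hcost G ω e ≡⟨ +-swap-inner (cost M₁) (hcost G ω e′) (cost M₂) (hcost G ω e) ⟩
    cost M₁ + (hcost G ω e + cost M₂) + hcost G ω e′ ≡⟨ cong (_+ hcost G ω e′) (cost-++-∷ M₁ e M₂) ⟨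
    cost (M₁ ++ e ∷ M₂) + hcost G ω e′               ∎
    where open ≡-Reasoning

  unmatched⇒apart : ∀ {M f} → ¬ Matched M f → All (λ g → yPart G ω g ≢ f) M
  unmatched⇒apart ¬m = All.tabulate λ {g} g∈ eq → ¬m (g , g∈ , eq)

  matching-∷ : ∀ {M u v f} → Matching M → HEdge G ω C (u , v , f) → (∀ t → (u , v , t) ∉ₗ M) → ¬ Matched M f →
               Matching ((u , v , f) ∷ M)
  matching-∷ (edges , apart) e ¬end ¬m =
    e ∷ edges ,
    All.tabulate (λ { {a , b , t} g∈ → (λ { refl → ¬end t g∈ }) , (λ eq → ¬m (_ , g∈ , sym eq)) }) ∷ apart

  matching-swap : ∀ M₁ {u v t f M₂} → Matching (M₁ ++ (u , v , t) ∷ M₂) → HEdge G ω C (u , v , f) →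
                  ¬ Matched (M₁ ++ (u , v , t) ∷ M₂) f → Matching (M₁ ++ (u , v , f) ∷ M₂)
  matching-swap M₁ (edges , apart) e ¬m =
    All-swap M₁ edges e ,
    AllPairs-swap M₁ apart (All.map (λ f-free (x≢ , _) → x≢ , f-free) (++⁻ˡ M₁ (unmatched⇒apart ¬m)))
                           (All.map (λ f-free (x≢ , _) → x≢ , f-free ∘ sym) (All.tail (++⁻ʳ M₁ (unmatched⇒apart ¬m))))

  swap-unmatched : ∀ M₁ {u v t f M₂} → Matching (M₁ ++ (u , v , t) ∷ M₂) → t ≢ f →
                   ¬ Matched (M₁ ++ (u , v , f) ∷ M₂) t
  swap-unmatched M₁ (_ , apart) t≢f (g , g∈ , eq) with ∈-++⁻ M₁ g∈ | AllPairs-++-∷⁻ M₁ apart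
  ... | inj₁ g∈M₁         | left , _  = proj₂ (All.lookup left g∈M₁) eq
  ... | inj₂ (here refl)  | _         = t≢f (sym eq)
  ... | inj₂ (there g∈M₂) | _ , right = proj₂ (All.lookup right g∈M₂) (sym eq)

-- Improving a rooted tour

module Improvement {n : ℕ} (G : Graph n) (ω : Weight n) (ω-sym : Symmetric ω)
                   (C : Subset n) (cover : IsVertexCover G ω C) (c₀ : Fin n) (c₀∈C : c₀ ∈ C) where

  open Walks G ω
  open Counting G ω
  open HopGraph G ω ω-sym C cover
  open Matchings G ω C

  record RootedTour (P : List (Fin n)) : Set where
    field
      closed : ClosedAt c₀ P
      covers : ∀ z → z ∈ₗ P
    open ClosedAt closed public

  rooted⇒tour : ∀ {P} → RootedTour P → Tour P
  rooted⇒tour rt = (((c₀ , starts) , adjacent) , (c₀ , starts , ends)) , covers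
    where open RootedTour rt

  tour⇒rooted : ∀ {R} → Tour R → head R ≡ just c₀ → RootedTour R
  tour⇒rooted (((_ , adjacent-R) , (_ , starts , ends)) , covers-R) starts-c₀ = record
    { closed = record { adjacent = adjacent-R ; starts = starts-c₀ ; ends = trans ends (trans (sym starts) starts-c₀) }
    ; covers = covers-R }

  hops : List (Fin n) → ℕ
  hops = count hop?

  -- Since the walk starts and ends in C, every occurrence of a vertex outside C has two neighbours in the walk.
  middle-triple : ∀ {P y} → ClosedAt c₀ P → y ∈ₗ P → y ∉ C → ∃₂ λ u v → Triple u y v P
  middle-triple {P} {y} cl y∈P y∉C with ∈-∃++ y∈P
  ... | []     , ys     , refl = ⊥-elim (y∉C (subst (_∈ C) (just-injective (sym (ClosedAt.starts cl))) c₀∈C))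
  ... | a ∷ as , []     , refl = ⊥-elim (y∉C (subst (_∈ C) (just-injective (trans (sym (ClosedAt.ends cl)) (last-∷ʳ (a ∷ as) y))) c₀∈C))
  ... | a ∷ as , b ∷ bs , refl with ∷-∷ʳ a as
  ...   | xs , u , a∷as≡ = u , b , subst (Triple u y b) (sym split) (split⇒triple xs bs)
    where
    split : (a ∷ as) ++ y ∷ b ∷ bs ≡ xs ++ u ∷ y ∷ b ∷ bs
    split = trans (cong (_++ y ∷ b ∷ bs) a∷as≡) (++-assoc xs [ u ] (y ∷ b ∷ bs))

  -- The extra triple of the cyclic reading is centred at the root c₀ ∈ C.
  cyclic-triple : ∀ {u s v} P → last P ≡ just c₀ → s ∉ C → Triple u s v (cyclicExt G ω P) → Triple u s v P
  cyclic-triple []          _    _   t = t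
  cyclic-triple (_ ∷ [])    _    _   t = t
  cyclic-triple (x ∷ y ∷ r) ends s∉C t with triple-∷ʳ⁻ (x ∷ y ∷ r) y t
  ... | inj₁ t′   = t′
  ... | inj₂ last≡ = ⊥-elim (s∉C (subst (_∈ C) (just-injective (trans (sym ends) last≡)) c₀∈C))

  record Visit (Q : List (Fin n)) (s : Fin n) : Set₁ where
    field
      walk       : List (Fin n)
      closed     : ClosedAt c₀ walk
      weight     : W walk ≤ W Q + 2 * ω-min s
      keeps      : Q ⊆ walk
      visits     : s ∈ₗ walk
      same-count : ∀ {φ} (φ? : Decidable³ φ) → HopLike φ → count φ? walk ≡ count φ? Q

  -- A missing vertex s is inserted as a loop w s w through its lightest edge; w ∈ C lies on the walk.
  visit : ∀ {Q s w} → ClosedAt c₀ Q → s ∉ C → E G s w → (∀ {z} → z ∈ C → z ∈ₗ Q) → Visit Q s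
  visit {Q} {s} cl s∉C e C⊆Q with s ∈? Q
  ... | yes s∈Q = record { walk = Q ; closed = cl ; weight = m≤m+n (W Q) _ ; keeps = id ; visits = s∈Q
                         ; same-count = λ _ _ → refl }
  ... | no _ with ω-min-attained e
  ...   | w , e′ , ω-minimal with ∈-∃++ (C⊆Q (neighbour∈C s∉C (E-sym G e′)))
  ...     | xs , ys , refl = record
    { walk       = with-loop
    ; closed     = closed-with cl (E-sym G e′)
    ; weight     = ≤-reflexive (trans weight (cong (W without-loop +_) (cheapest-loop ω-minimal)))
    ; keeps      = ∈-with
    ; visits     = f∈with
    ; same-count = λ φ? hop-like → count-loop φ? hop-like (neighbour∈C s∉C (E-sym G e′)) }
    where open Loop xs ys w s

  SingleMiddles : List (Fin n) → Set
  SingleMiddles P = ∀ {u v a b} → u ≢ v → a ∉ C → b ∉ C → Triple u a v P → Triple u b v P → a ≡ b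

  TwoMiddles : List (Fin n) → Fin n → Fin n → Fin n → Fin n → Set
  TwoMiddles P u v a b = u ≢ v × a ∉ C × b ∉ C × a ≢ b × Triple u a v P × Triple u b v P

  single-middles? : ∀ P → (∃[ u ] ∃[ v ] ∃[ a ] ∃[ b ] TwoMiddles P u v a b) ⊎ SingleMiddles P
  single-middles? P with any-Fin? (λ u → any-Fin? (λ v → any-Fin? (λ a → any-Fin? (λ b → two-middles? u v a b))))
    where
    two-middles? : ∀ u v a b → Dec (TwoMiddles P u v a b)
    two-middles? u v a b = ¬? (u ≟ v) ×-dec ¬? (a Subset.∈? C) ×-dec ¬? (b Subset.∈? C) ×-dec ¬? (a ≟ b)
                           ×-dec triple? u a v P ×-dec triple? u b v P
  ... | yes found = inj₁ found
  ... | no ¬found = inj₂ λ {u} {v} {a} {b} u≢v a∉C b∉C t₁ t₂ →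
          decidable-stable (a ≟ b) λ a≢b → ¬found (u , v , a , b , u≢v , a∉C , b∉C , a≢b , t₁ , t₂)

  -- Both hops are cut out and their middles revisited by cheapest loops if necessary; by loop≤hop this is no dearer.
  drop-parallel-hops : ∀ {T u v a b} → RootedTour T → TwoMiddles T u v a b →
                       ∃[ T′ ] RootedTour T′ × W T′ ≤ W T × hops T′ < hops T ×
                         (∀ {φ} (φ? : Decidable³ φ) → HopLike φ → Reversible φ → count φ? T′ ≤ count φ? T)
  drop-parallel-hops {T} {u} {v} rt (u≢v , a∉C , b∉C , a≢b , t₁ , t₂) with triple⇒adjacent (RootedTour.adjacent rt) t₁
  ... | e₁ , e₂ with parallel-hops T (neighbour∈C a∉C e₁) a∉C b∉C u≢v a≢b t₁ t₂
  ... | xs , mid , ys , x , y , refl , x∉C , y∉C =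
    Visit.walk V₂ , record { closed = Visit.closed V₂ ; covers = covers′ } , weight′ , fewer-hops , fewer
    where
    open ParallelHops xs mid ys u x y v
    u∈C : u ∈ C
    u∈C = neighbour∈C a∉C e₁
    v∈C : v ∈ C
    v∈C = neighbour∈C a∉C (E-sym G e₂)
    hop-x : E G u x × E G x v
    hop-x = triple⇒adjacent (RootedTour.adjacent rt) (split⇒triple xs (mid ++ u ∷ y ∷ v ∷ ys))
    hop-y : E G u y × E G y v
    hop-y = triple⇒adjacent (RootedTour.adjacent rt)
      (subst (Triple u y v) (++-assoc xs (u ∷ x ∷ v ∷ mid) (u ∷ y ∷ v ∷ ys)) (split⇒triple (xs ++ u ∷ x ∷ v ∷ mid) ys))
    C⊆after : ∀ {z} → z ∈ C → z ∈ₗ after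
    C⊆after {z} z∈C = ∈-after (RootedTour.covers rt z) (λ { refl → x∉C z∈C }) (λ { refl → y∉C z∈C })
    V₁ : Visit after x
    V₁ = visit (closed-after (RootedTour.closed rt)) x∉C (proj₂ hop-x) C⊆after
    V₂ : Visit (Visit.walk V₁) y
    V₂ = visit (Visit.closed V₁) y∉C (proj₂ hop-y) (Visit.keeps V₁ ∘ C⊆after)
    covers′ : ∀ z → z ∈ₗ Visit.walk V₂
    covers′ z with z ≟ x | z ≟ y
    ... | yes refl | _        = Visit.keeps V₂ (Visit.visits V₁)
    ... | no _     | yes refl = Visit.visits V₂
    ... | no z≢x   | no z≢y   = Visit.keeps V₂ (Visit.keeps V₁ (∈-after (RootedTour.covers rt z) z≢x z≢y))
    weight′ : W (Visit.walk V₂) ≤ W before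
    weight′ = begin
      W (Visit.walk V₂)                   ≤⟨ Visit.weight V₂ ⟩
      W (Visit.walk V₁) + 2 * ω-min y     ≤⟨ +-monoˡ-≤ _ (Visit.weight V₁) ⟩
      W after + 2 * ω-min x + 2 * ω-min y ≡⟨ +-assoc (W after) _ _ ⟩
      W after + (2 * ω-min x + 2 * ω-min y)
        ≤⟨ +-monoʳ-≤ (W after) (+-mono-≤ (loop≤hop (proj₁ hop-x) (proj₂ hop-x)) (loop≤hop (proj₁ hop-y) (proj₂ hop-y))) ⟩
      W after + ((ω u x + ω x v) + (ω u y + ω y v)) ≡⟨ weight ⟨
      W before                                      ∎
      where open ≤-Reasoning
    fewer-hops : hops (Visit.walk V₂) < hops before
    fewer-hops = begin-strict
      hops (Visit.walk V₂) ≡⟨ Visit.same-count V₂ hop? id ⟩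
      hops (Visit.walk V₁) ≡⟨ Visit.same-count V₁ hop? id ⟩
      hops after           <⟨ m<m+n (hops after) z<s ⟩
      hops after + (1 + 1)
        ≡⟨ cong (hops after +_) (cong₂ _+_ (indicator-yes (hop? u x v) (x∉C , u≢v)) (indicator-yes (hop? u y v) (y∉C , u≢v))) ⟨
      hops after + (indicator (hop? u x v) + indicator (hop? u y v))
        ≡⟨ count-drop hop? id (λ (y∉C , u≢v) → y∉C , u≢v ∘ sym) u∈C v∈C ⟨
      hops before                         ∎
      where open ≤-Reasoning
    fewer : ∀ {φ} (φ? : Decidable³ φ) → HopLike φ → Reversible φ → count φ? (Visit.walk V₂) ≤ count φ? before
    fewer φ? hop-like reversible = begin
      count φ? (Visit.walk V₂)                                       ≡⟨ Visit.same-count V₂ φ? hop-like ⟩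
      count φ? (Visit.walk V₁)                                       ≡⟨ Visit.same-count V₁ φ? hop-like ⟩
      count φ? after                                                 ≤⟨ m≤m+n _ _ ⟩
      count φ? after + (indicator (φ? u x v) + indicator (φ? u y v)) ≡⟨ count-drop φ? hop-like reversible u∈C v∈C ⟨
      count φ? before                                                ∎
      where open ≤-Reasoning

  module Exchange (M* : List Edge) (optimal-M* : IsMinCostMaxCardMatching G ω C M*) where

    open DecMembership _≟₂_ using () renaming (_∈?_ to _∈ₚ?_)

    IsBadHop : Pred³
    IsBadHop u y v = IsHop u y v × ¬ Matched M* y

    bad? : Decidable³ IsBadHop
    bad? u y v = hop? u y v ×-dec ¬? (matched? M* y)

    bad : List (Fin n) → ℕ
    bad = count bad?

    bad-reversible : Reversible IsBadHop
    bad-reversible ((y∉C , u≢v) , y-free) = (y∉C , u≢v ∘ sym) , y-free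

    Result : List (Fin n) → Set
    Result P = ∃[ T ] RootedTour T × W T ≤ W P × bad T < bad P × hops T ≡ hops P

    -- Starting from a hop u₀ s v₀ with s unmatched, each step hands the hop u f v of the free vertex f to the
    -- M*-partner t of (u , v) and replaces (u , v , t) by (u , v , f) in the matching; W Q + cost M − 2 ω-min f
    -- stays constant, and cost M* ≤ cost M at the end because M is again a maximum matching.
    module Chain (P : List (Fin n)) (rt : RootedTour P) (single : SingleMiddles P)
                 {s u₀ v₀ : Fin n} (u₀≢v₀ : u₀ ≢ v₀) (s∉C : s ∉ C) (s-free : ¬ Matched M* s) (hop-s : Triple u₀ s v₀ P) where

      Ends : Set
      Ends = Fin n × Fin n

      data Progress (Q : List (Fin n)) (f : Fin n) (Ch : List Ends) : Set where
        start : f ≡ s → bad Q ≤ bad P → Progress Q f Ch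
        moved : ∀ {u v} → f ≢ s → bad Q < bad P → u ≢ v → (u , v) ∈ₗ Ch → Triple u f v Q → Progress Q f Ch

      record State (Q : List (Fin n)) (M : List Edge) (f : Fin n) (Ch : List Ends) : Set where
        field
          closed    : ClosedAt c₀ Q
          covers    : ∀ {z} → z ≢ s → z ∈ₗ Q
          progress  : Progress Q f Ch
          untouched : ∀ {u y v} → (u , v) ∉ₗ Ch → y ∉ C → Triple u y v P → Triple u y v Q
          processed : ∀ {u y v} → (u , v) ∈ₗ Ch → y ∉ C → Triple u y v P → (u , v , y) ∈ₗ M
          matching  : Matching M
          same-size : length M ≡ length M*
          f-free    : ¬ Matched M f
          from-M*   : ∀ {u v y} → (u , v) ∉ₗ Ch → (u , v , y) ∈ₗ M → (u , v , y) ∈ₗ M*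
          balance   : W Q + cost M + 2 * ω-min s ≡ W P + cost M* + 2 * ω-min f
          f∉C       : f ∉ C
          same-hops : hops Q ≡ hops P

      initial : State P M* s []
      initial = record
        { closed = RootedTour.closed rt ; covers = λ _ → RootedTour.covers rt _ ; progress = start refl ≤-refl
        ; untouched = λ _ _ t → t ; processed = λ () ; matching = proj₁ (proj₁ optimal-M*) ; same-size = refl
        ; f-free = s-free ; from-M* = λ _ e∈ → e∈ ; balance = refl ; f∉C = s∉C ; same-hops = refl }

      ends∈C : ∀ {u y v L} → Adjacent L → y ∉ C → Triple u y v L → u ∈ C × v ∈ C
      ends∈C l y∉C t = let (e₁ , e₂) = triple⇒adjacent l t in neighbour∈C y∉C e₁ , neighbour∈C y∉C (E-sym G e₂)

      hop-edge : ∀ {u f v} → u ≢ v → f ∉ C → Triple u f v P → HEdge G ω C (u , v , f)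
      hop-edge u≢v f∉C t =
        let (e₁ , e₂) = triple⇒adjacent (RootedTour.adjacent rt) t
            (u∈C , v∈C) = ends∈C (RootedTour.adjacent rt) f∉C t
        in u∈C , v∈C , u≢v , f∉C , e₁ , E-sym G e₂

      -- Otherwise adding the edge (u , v , f) would give a larger matching.
      pair-matched : ∀ {Q M f Ch u v} → State Q M f Ch → u ≢ v → Triple u f v P → ∃[ t ] (u , v , t) ∈ₗ M
      pair-matched {M = M} st u≢v t with pair-matched? M _ _
      ... | inj₁ found = found
      ... | inj₂ ¬end  = ⊥-elim (<-irrefl refl (subst (λ k → suc k ≤ length M*) same-size
                           (proj₂ (proj₁ optimal-M*) _ (matching-∷ matching (hop-edge u≢v f∉C t) ¬end f-free))))
        where open State st

      module Step {xs ys M₁ M₂ u f t v Ch} (st : State (xs ++ u ∷ f ∷ v ∷ ys) (M₁ ++ (u , v , t) ∷ M₂) f Ch)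
                  (u≢v : u ≢ v) (new : (u , v) ∉ₗ Ch) (hop-f : Triple u f v P) where

        open State st
        open ReplaceMiddle xs ys u f t v
        M M′ : List Edge
        M = M₁ ++ (u , v , t) ∷ M₂
        M′ = M₁ ++ (u , v , f) ∷ M₂

        t∈M : (u , v , t) ∈ₗ M
        t∈M = ∈-++⁺ʳ M₁ (here refl)

        t-edge : HEdge G ω C (u , v , t)
        t-edge = All.lookup (proj₁ matching) t∈M

        t∉C : t ∉ C
        t∉C with t-edge
        ... | _ , _ , _ , t∉C , _ = t∉C

        e-ut : E G u t
        e-ut with t-edge
        ... | _ , _ , _ , _ , e , _ = e

        e-tv : E G t v
        e-tv with t-edge
        ... | _ , _ , _ , _ , _ , e = E-sym G e

        e-uf : E G u f
        e-uf = proj₁ (triple⇒adjacent (RootedTour.adjacent rt) hop-f)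

        e-fv : E G f v
        e-fv = proj₂ (triple⇒adjacent (RootedTour.adjacent rt) hop-f)

        u∈C : u ∈ C
        u∈C = neighbour∈C f∉C e-uf

        v∈C : v ∈ C
        v∈C = neighbour∈C f∉C (E-sym G e-fv)

        t-matched* : Matched M* t
        t-matched* = _ , from-M* new t∈M , refl

        t≢s : t ≢ s
        t≢s refl = s-free t-matched*

        t≢f : t ≢ f
        t≢f refl = f-free (_ , t∈M , refl)

        other-ends : ∀ {u′ v′} {A : Set} → (u′ , v′) ∈ₗ Ch → (u′ ≡ u × A × v′ ≡ v) → ⊥
        other-ends ∈Ch (refl , _ , refl) = new ∈Ch

        still-there : ∀ {u′ y v′} → y ∉ C → (u′ , v′) ∉ₗ (u , v) ∷ Ch → Triple u′ y v′ before → Triple u′ y v′ after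
        still-there y∉C ∉Ch′ t′ = let (u′∈C , v′∈C) = ends∈C (ClosedAt.adjacent closed) y∉C t′ in
          triple-preserved f∉C u′∈C v′∈C (λ { (refl , _ , refl) → ∉Ch′ (here refl) }) t′

        covers′ : ∀ {z} → z ≢ s → z ∈ₗ after
        covers′ {z} z≢s with z ≟ f | progress
        ... | no z≢f    | _                          = ∈-after (covers z≢s) z≢f
        ... | yes refl  | start f≡s _                = ⊥-elim (z≢s f≡s)
        ... | yes refl  | moved _ _ _ ∈Ch t′         =
          let (u′∈C , v′∈C) = ends∈C (ClosedAt.adjacent closed) f∉C t′ in
          triple⇒∈ (triple-preserved f∉C u′∈C v′∈C (other-ends ∈Ch) t′)

        exchanged : bad after + indicator (bad? u f v) ≡ bad before
        exchanged = begin
          bad after + indicator (bad? u f v)  ≡⟨ count-exchange bad? proj₁ u∈C v∈C ⟩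
          bad before + indicator (bad? u t v) ≡⟨ cong (bad before +_) (indicator-no (bad? u t v) λ (_ , t-free) → t-free t-matched*) ⟩
          bad before + 0                      ≡⟨ +-identityʳ (bad before) ⟩
          bad before                          ∎
          where open ≡-Reasoning

        fewer-bad : bad after < bad P
        fewer-bad with progress
        ... | start refl bad≤ = begin-strict
          bad after                          <⟨ m<m+n (bad after) z<s ⟩
          bad after + 1                      ≡⟨ cong (bad after +_) (indicator-yes (bad? u f v) ((f∉C , u≢v) , s-free)) ⟨
          bad after + indicator (bad? u f v) ≡⟨ exchanged ⟩
          bad before                         ≤⟨ bad≤ ⟩
          bad P                              ∎
          where open ≤-Reasoning
        ... | moved _ bad< _ _ _ = begin-strict
          bad after                          ≤⟨ m≤m+n (bad after) _ ⟩
          bad after + indicator (bad? u f v) ≡⟨ exchanged ⟩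
          bad before                         <⟨ bad< ⟩
          bad P                              ∎
          where open ≤-Reasoning

        processed′ : ∀ {u′ y v′} → (u′ , v′) ∈ₗ (u , v) ∷ Ch → y ∉ C → Triple u′ y v′ P → (u′ , v′ , y) ∈ₗ M′
        processed′ (here refl) y∉C t′ = subst (λ y → (u , v , y) ∈ₗ M′) (single u≢v f∉C y∉C hop-f t′) (∈-++⁺ʳ M₁ (here refl))
        processed′ (there ∈Ch) y∉C t′ = ∈-swap⁺ M₁ (processed ∈Ch y∉C t′) λ { refl → new ∈Ch }

        from-M*′ : ∀ {u′ v′ y} → (u′ , v′) ∉ₗ (u , v) ∷ Ch → (u′ , v′ , y) ∈ₗ M′ → (u′ , v′ , y) ∈ₗ M*
        from-M*′ ∉Ch′ e∈ with ∈-swap⁻ M₁ e∈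
        ... | inj₁ refl = ⊥-elim (∉Ch′ (here refl))
        ... | inj₂ e∈M  = from-M* (∉Ch′ ∘ there) e∈M

        same-hops′ : hops after ≡ hops P
        same-hops′ = trans (+-cancelʳ-≡ 1 (hops after) (hops before) (begin
          hops after + 1                       ≡⟨ cong (hops after +_) (indicator-yes (hop? u f v) (f∉C , u≢v)) ⟨
          hops after + indicator (hop? u f v)  ≡⟨ count-exchange hop? id u∈C v∈C ⟩
          hops before + indicator (hop? u t v) ≡⟨ cong (hops before +_) (indicator-yes (hop? u t v) (t∉C , u≢v)) ⟩
          hops before + 1                      ∎)) same-hops
          where open ≡-Reasoning

        next : State after M′ t ((u , v) ∷ Ch)
        next = record
          { closed    = closed-after closed e-ut e-tv
          ; covers    = covers′
          ; progress  = moved t≢s fewer-bad u≢v (here refl) triple-after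
          ; untouched = λ ∉Ch′ y∉C t′ → still-there y∉C ∉Ch′ (untouched (∉Ch′ ∘ there) y∉C t′)
          ; processed = processed′
          ; matching  = matching-swap M₁ matching (hop-edge u≢v f∉C hop-f) f-free
          ; same-size = trans (length-swap M₁ M₂) same-size
          ; f-free    = swap-unmatched M₁ matching t≢f
          ; from-M*   = from-M*′
          ; balance   = balance-step {w′ = W after} {s = 2 * ω-min s} {k = W P + cost M*} {w = W before} {c = cost M}
                          {costf = hcost G ω (u , v , f)} {costt = hcost G ω (u , v , t)} {loopf = 2 * ω-min f} {loopt = 2 * ω-min t}
                          weight (cost-swap M₁ (u , v , t) (u , v , f) M₂) (hop-cost e-uf e-fv) (hop-cost e-ut e-tv) balance
          ; f∉C       = t∉C
          ; same-hops = same-hops′ }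

      NewHop : Fin n → List Ends → Set
      NewHop f Ch = ∃[ u ] ∃[ v ] u ≢ v × (u , v) ∉ₗ Ch × Triple u f v P

      new-hop? : ∀ f Ch → Dec (NewHop f Ch)
      new-hop? f Ch = any-Fin? λ u → any-Fin? λ v → ¬? (u ≟ v) ×-dec ¬? ((u , v) ∈ₚ? Ch) ×-dec triple? u f v P

      -- With no new hop left, f occurs in P only in a loop u f u, which is cut out of Q; f stays on Q through the
      -- hop it took over, and s is put back by a loop if it was lost.
      finish : ∀ {Q M f Ch} → State Q M f Ch → ¬ NewHop f Ch → Result P
      finish {Q} {M} {f} {Ch} st none with middle-triple (RootedTour.closed rt) (RootedTour.covers rt f) f∉C
        where open State st
      ... | u , v , hop-f with (u , v) ∈ₚ? Ch
      ...   | yes ∈Ch = ⊥-elim (State.f-free st (_ , State.processed st ∈Ch (State.f∉C st) hop-f , refl))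
      ...   | no ∉Ch with u ≟ v
      ...     | no u≢v  = ⊥-elim (none (u , v , u≢v , ∉Ch , hop-f))
      ...     | yes refl with State.progress st
      ...       | start refl _ with (u₀ , v₀) ∈ₚ? Ch
      ...         | yes ∈Ch₀ = ⊥-elim (State.f-free st (_ , State.processed st ∈Ch₀ s∉C hop-s , refl))
      ...         | no ∉Ch₀  = ⊥-elim (none (u₀ , v₀ , u₀≢v₀ , ∉Ch₀ , hop-s))
      finish {Q} {M} {f} {Ch} st none | u , u , hop-f | no ∉Ch | yes refl | moved f≢s bad< u′≢v′ _ hop-f′
        with triple⇒split (State.untouched st ∉Ch (State.f∉C st) hop-f)
      ... | xs , ys , refl = Visit.walk V , record { closed = Visit.closed V ; covers = covers-T } ,
                             weight-T , fewer-bad , same-hops-T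
        where
        open State st
        open Loop xs ys u f
        loop-f : E G u f × E G f u
        loop-f = triple⇒adjacent (RootedTour.adjacent rt) hop-f
        u∈C : u ∈ C
        u∈C = neighbour∈C f∉C (proj₁ loop-f)
        covers′ : ∀ {z} → z ≢ s → z ∈ₗ without-loop
        covers′ {z} z≢s with z ≟ f
        ... | yes refl = triple⇒∈ (hop-preserved u∈C f∉C u′≢v′ hop-f′)
        ... | no z≢f   = ∈-without (covers z≢s) z≢f
        e-su₀ : E G s u₀
        e-su₀ = E-sym G (proj₁ (triple⇒adjacent (RootedTour.adjacent rt) hop-s))
        V : Visit without-loop s
        V = visit (closed-without closed) s∉C e-su₀ (λ z∈C → covers′ λ { refl → s∉C z∈C })
        covers-T : ∀ z → z ∈ₗ Visit.walk V
        covers-T z with z ≟ s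
        ... | yes refl = Visit.visits V
        ... | no z≢s   = Visit.keeps V (covers′ z≢s)
        cheaper : W without-loop + 2 * ω-min f ≤ W with-loop
        cheaper = ≤-trans (+-monoʳ-≤ (W without-loop) (loop≤hop (proj₁ loop-f) (proj₂ loop-f))) (≤-reflexive (sym weight))
        maximum-M : IsMaxCardMatching G ω C M
        maximum-M = matching , λ M′ m′ → subst (length M′ ≤_) (sym same-size) (proj₂ (proj₁ optimal-M*) M′ m′)
        weight-T : W (Visit.walk V) ≤ W P
        weight-T = balance-finish {wq′ = W without-loop} (Visit.weight V) cheaper balance (proj₂ optimal-M* M maximum-M)
        fewer-bad : bad (Visit.walk V) < bad P
        fewer-bad = ≤-<-trans (≤-reflexive (trans (Visit.same-count V bad? proj₁) (sym (count-loop bad? proj₁ u∈C)))) bad<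
        same-hops-T : hops (Visit.walk V) ≡ hops P
        same-hops-T = trans (Visit.same-count V hop? id) (trans (sym (count-loop hop? id u∈C)) same-hops)

      unprocessed : List Ends → ℕ
      unprocessed Ch = count (λ u y v → hop? u y v ×-dec ¬? ((u , v) ∈ₚ? Ch)) P

      run : ∀ k {Q M f Ch} → State Q M f Ch → unprocessed Ch < k → Result P
      run (suc k) {Q} {M} {f} {Ch} st bound with new-hop? f Ch
      ... | no none = finish st none
      ... | yes (u , v , u≢v , ∉Ch , hop-f) with pair-matched st u≢v hop-f
      ...   | t , t∈M with triple⇒split (State.untouched st ∉Ch (State.f∉C st) hop-f) | ∈-∃++ t∈M
      ...     | xs , ys , refl | M₁ , M₂ , refl =
        run k (Step.next st u≢v ∉Ch hop-f) (≤-trans fewer (≤-pred bound))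
        where
        fewer : unprocessed ((u , v) ∷ Ch) < unprocessed Ch
        fewer = count-mono-< _ _ (λ _ _ _ (hop , ∉Ch′) → hop , ∉Ch′ ∘ there) P hop-f
                  ((State.f∉C st , u≢v) , ∉Ch) (λ (_ , ∉Ch′) → ∉Ch′ (here refl))

      result : Result P
      result = run (suc (unprocessed [])) initial ≤-refl

    eliminate-bad-hops : ∀ k {T} → RootedTour T → bad T + hops T < k → ∃[ T′ ] RootedTour T′ × W T′ ≤ W T × bad T′ ≡ 0
    eliminate-bad-hops (suc k) {T} rt bound with single-middles? T
    ... | inj₁ (_ , _ , _ , _ , two) with drop-parallel-hops rt two
    ...   | T′ , rt′ , W≤ , hops< , counts≤
      with eliminate-bad-hops k rt′ (≤-trans (+-mono-≤-< (counts≤ bad? proj₁ bad-reversible) hops<) (≤-pred bound))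
    ...     | T″ , rt″ , W≤′ , none = T″ , rt″ , ≤-trans W≤′ W≤ , none
    eliminate-bad-hops (suc k) {T} rt bound | inj₂ single with bad T in eq
    ... | zero  = T , rt , ≤-refl , eq
    ... | suc _ with count>0⇒triple bad? T (subst (0 <_) (sym eq) z<s)
    ...   | u , y , v , hop-y , ((y∉C , u≢v) , y-free) with Chain.result T rt single u≢v y∉C y-free hop-y
    ...     | T′ , rt′ , W≤ , bad< , same
      with eliminate-bad-hops k rt′ (≤-trans (+-mono-<-≤ (subst (bad T′ <_) eq bad<) (≤-reflexive same)) (≤-pred bound))
    ...       | T″ , rt″ , W≤′ , none = T″ , rt″ , ≤-trans W≤′ W≤ , none

    matched-hops : ∀ {R} → RootedTour R → (∀ ws → Tour ws → W R ≤ W ws) →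
                   ∃[ P ] IsOptimalTSPTour G ω P × (∀ s → TraversesViaHop G ω C P s → Matched M* s)
    matched-hops {R} rt optimal-R with eliminate-bad-hops (suc (bad R + hops R)) rt ≤-refl
    ... | T , rt-T , W≤ , none = T , (rooted⇒tour rt-T , λ ws tour-ws → ≤-trans W≤ (optimal-R ws tour-ws)) , matched
      where
      matched : ∀ s → TraversesViaHop G ω C T s → Matched M* s
      matched s (s∉C , u , v , u≢v , hop) with matched? M* s
      ... | yes m = m
      ... | no ¬m = ⊥-elim (<-irrefl (sym none)
                      (triple⇒count>0 bad? (cyclic-triple T (RootedTour.ends rt-T) s∉C hop) ((s∉C , u≢v) , ¬m)))

hop⇒meets-cover : ∀ {n} {G : Graph n} {ω : Weight n} {C P u s v} → IsVertexCover G ω C → Walks.Tour G ω P →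
                  HasTriple G ω u s v (cyclicExt G ω P) → ∃[ c ] c ∈ₗ P × c ∈ C
hop⇒meets-cover {P = x ∷ y ∷ _} cover ((((_ , _) , e ∷ _) , _) , _) _ with cover x y e
... | inj₁ x∈C = x , here refl , x∈C
... | inj₂ y∈C = y , there (here refl) , y∈C
hop⇒meets-cover {P = _ ∷ []} cover _ (there ())

lemma3 : ∀ {n} (G : Graph n) (ω : Weight n) → Symmetric ω →
    (∃[ T ] IsTSPTour G ω T) →
    (C : Subset n) → IsVertexCover G ω C →
    (τ : ℕ) → IsMinVertexCoverSize G ω τ → ∣ C ∣ ≤ 2 * τ →
    (M : List (Fin n × Fin n × Fin n)) → IsMinCostMaxCardMatching G ω C M →
    ∃[ P ] (IsOptimalTSPTour G ω P ×
      (∀ s → TraversesViaHop G ω C P s → MatchedBy G ω M s))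
lemma3 G ω ω-sym tour C cover _ _ _ M optimal-M with optimal-tour G ω tour
... | P , tour-P , optimal-P with Any.any? (Subset._∈? C) P
...   | no ¬meets = P , (tour-P , optimal-P) , λ s (_ , _ , _ , _ , hop) →
          let (c , c∈P , c∈C) = hop⇒meets-cover cover tour-P hop in ⊥-elim (¬meets (lose c∈P c∈C))
...   | yes meets with find meets
...     | c₀ , c₀∈P , c₀∈C with rotate G ω tour-P c₀∈P
...       | R , tour-R , W≡ , starts-c₀ =
  Exchange.matched-hops M optimal-M (tour⇒rooted tour-R starts-c₀)
    (λ ws tour-ws → subst (_≤ walkWeight G ω ws) (sym W≡) (optimal-P ws tour-ws))
  where open Improvement G ω ω-sym C cover c₀ c₀∈C
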